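{- Let $n,d$ be natural numbers with $d<n$. Then $$\big|\{f\in\mathbb{F}_q[x]:\ f\text{ monic},\ \deg f=n,\ \deg\mathrm{rad}(f)\le d\}\big|=q^{d+o(n)},$$ where the $o(n)$ term (as $n\to\infty$) is uniform in $d$.
   Context: $q$ is a prime power. For $f\in\mathbb{F}_q[x]$ with factorization $f=c\prod P_i^{e_i}$ into distinct monic irreducibles $P_i$ ($e_i\ge1$), $\mathrm{rad}(f)=\prod P_i$. -}

module Defs where

open import Level using (0ℓ)
open import Data.Nat using (ℕ; zero; suc; _+_; _≤_; _≤?_; _∸_)
open import Data.Fin using (Fin)
open import Data.Fin.Properties using () renaming (_≟_ to _≟F_)
open import Data.Bool using (Bool; true; false; _∧_; if_then_else_)
open import Data.List using (List; []; _∷_; _++_; map; concatMap; length; filter; upTo; allFin)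
open import Data.Bool.ListAction using (any; all)
open import Data.Nat.ListAction using (sum)
open import Data.List.Properties using (≡-dec)
open import Data.Vec using (Vec; toList) renaming ([] to []ᵥ; _∷_ to _∷ᵥ_)

open import Data.Product using (Σ; ∃; _×_; _,_)
open import Relation.Binary.PropositionalEquality using (_≡_; _≢_)
open import Relation.Nullary.Decidable using (⌊_⌋; _because_)
open import Algebra.Structures using (IsCommutativeRing)

-- A finite field with q elements, with carrier Fin q (every finite field
-- of order q is isomorphic to one of this form; q is then automatically a
-- prime power).

record FiniteField (q : ℕ) : Set where
  field
    _+ᶠ_ _*ᶠ_ : Fin q → Fin q → Fin q
    -ᶠ_       : Fin q → Fin q
    0ᶠ 1ᶠ     : Fin q
    isCommutativeRing : IsCommutativeRing _≡_ _+ᶠ_ _*ᶠ_ -ᶠ_ 0ᶠ 1ᶠ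
    0≢1       : 0ᶠ ≢ 1ᶠ
    inverse   : ∀ x → x ≢ 0ᶠ → ∃ λ y → x *ᶠ y ≡ 1ᶠ

allVecs : (q m : ℕ) → List (Vec (Fin q) m)
allVecs q zero    = []ᵥ ∷ []
allVecs q (suc m) = concatMap (λ a → map (a ∷ᵥ_) (allVecs q m)) (allFin q)

module Poly {q : ℕ} (F : FiniteField q) where
  open FiniteField F

  -- Polynomials as little-endian coefficient lists  a₀ ∷ a₁ ∷ … .
  Pol : Set
  Pol = List (Fin q)

  _⊕_ : Pol → Pol → Pol
  []      ⊕ g       = g
  (a ∷ f) ⊕ []      = a ∷ f
  (a ∷ f) ⊕ (b ∷ g) = (a +ᶠ b) ∷ (f ⊕ g)

  _⊛_ : Pol → Pol → Pol
  []      ⊛ g = []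
  (a ∷ f) ⊛ g = map (a *ᶠ_) g ⊕ (0ᶠ ∷ (f ⊛ g))

  monic : ∀ {m} → Vec (Fin q) m → Pol
  monic v = toList v ++ (1ᶠ ∷ [])

  _==_ : Pol → Pol → Bool
  f == g = ⌊ ≡-dec _≟F_ f g ⌋

  -- Monic P (degree m) divides monic f (degree n): f = P * g for some
  -- (necessarily monic, degree n ∸ m) polynomial g.
  divides : ∀ {m n} → Vec (Fin q) m → Vec (Fin q) n → Bool
  divides {m} {n} P f with m ≤? n
  ... | false because _ = false
  ... | true  because _ =
        any (λ g → (monic P ⊛ monic g) == monic f) (allVecs q (n ∸ m))

  irreducible : ∀ {m} → Vec (Fin q) m → Bool
  irreducible {zero}  P = false
  irreducible {suc m} P =
    all (λ i → all (λ A → all (λ B → not ((monic A ⊛ monic B) == monic P))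
                                  (allVecs q (suc m ∸ suc i)))
                       (allVecs q (suc i)))
        (upTo m)
    where
      open import Data.Bool using (not)

  -- deg rad(f) for monic f of degree n: the sum of the degrees of the
  -- distinct monic irreducible polynomials dividing f.
  degRad : ∀ {n} → Vec (Fin q) n → ℕ
  degRad {n} f =
    sum (map (λ j → sum (map (λ P → if irreducible P ∧ divides P f then suc j else 0)
                              (allVecs q (suc j))))
             (upTo n))

  count : (n d : ℕ) → ℕ
  count n d = length (filter (λ f → degRad f ≤? d) (allVecs q n))

-- A monic f of degree n is the product of powers P ^ e_P of its distinct monic irreducible
-- divisors P, and the product of these P is the radical r of f, of degree degRad f; so f is
-- determined by r together with the exponents e_P, which satisfy Σ e_P deg P = n. At most
-- L q^L of the P have degree below L, and each of their exponents is at most n; the P of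
-- degree at least L number at most n / L and their exponents sum to at most n / L, leaving
-- at most 2^(2 n / L) choices. Hence
--   count n d ≤ (d + 1) q^d (n + 1)^(L q^L) 2^(2 n / L),
-- which is q^(d + o(n)) when L = 4k. Conversely, x^(n - d + 1) g has a radical of degree at
-- most d for each of the q^(d - 1) monic g of degree d - 1.
-- Unique factorization rests on Euclid's lemma for irreducible polynomials, proved by
-- division with remainder.

module Submission where

open import Defs
open import Level using (0ℓ)
open import Function using (_∘_; id)
open import Function.Bundles using (Equivalence)
open import Data.Empty using (⊥; ⊥-elim)
open import Data.Product using (Σ; ∃; _×_; _,_; proj₁; proj₂)
open import Data.Sum using (_⊎_; inj₁; inj₂)
open import Data.Bool using (Bool; true; false; T; not; _∧_; if_then_else_)
open import Data.Bool.ListAction using (all)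
open import Data.Bool.Properties using (T-∧)
open import Data.Nat using (ℕ; zero; suc; _+_; _*_; _^_; _∸_; _≤_; _<_; _≤?_; _<?_; _⊔_; z≤n; s≤s; NonZero; >-nonZero)
open import Data.Nat.Properties
open import Data.Nat.DivMod using (_/_; _%_; m*n/n≡m; /-monoˡ-≤; m/n*n≤m; m≡m%n+[m/n]*n; m%n<n)
open import Data.Nat.Induction using (<-rec)
open import Data.Nat.ListAction using (sum)
open import Data.Nat.ListAction.Properties using (sum-++)
open import Data.Nat.Solver using (module +-*-Solver)
open import Data.Fin using (Fin)
open import Data.Fin.Properties using (toℕ<n; toℕ-injective) renaming (_≟_ to _≟F_)
open import Data.Vec using (Vec) renaming ([] to []ᵥ; _∷_ to _∷ᵥ_)
open import Data.Vec.Properties using (∷-injective)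
open import Data.List using (List; []; _∷_; _++_; map; length; concatMap; applyUpTo; upTo; allFin; filter; foldr)
open import Data.List.Properties
  using (length-++; length-map; length-upTo; length-tabulate; length-removeAt′; map-++; map-∘; map-cong; map-applyUpTo;
         concatMap-cong; filter-≐; filter-accept; filter-reject)
open import Data.List.Membership.Propositional using (_∈_; _─_; find)
open import Data.List.Membership.Propositional.Properties
  using (∈-allFin; ∈-map⁺; ∈-map⁻; ∈-concatMap⁺; ∈-concatMap⁻; ∈-upTo⁺; ∈-upTo⁻; ∈-filter⁺; ∈-filter⁻)
open import Data.List.Relation.Unary.Any as Any using (here; there)
import Data.List.Relation.Unary.Any.Properties as Anyₚ
open import Data.List.Relation.Unary.All as All using (All; []; _∷_)
import Data.List.Relation.Unary.All.Properties as Allₚ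
open import Data.List.Relation.Unary.All.Properties.Core using (¬All⇒Any¬)
open import Data.List.Relation.Unary.AllPairs as AllPairs using ([]; _∷_)
import Data.List.Relation.Unary.AllPairs.Properties as AllPairsₚ
open import Data.List.Relation.Unary.Unique.Propositional using (Unique)
import Data.List.Relation.Unary.Unique.Propositional.Properties as Uniqueₚ
open import Data.List.Relation.Binary.Disjoint.Propositional using (Disjoint)
open import Data.List.Relation.Binary.Subset.Propositional using (_⊆_)
open import Relation.Nullary using (¬_; Dec; yes; no)
open import Relation.Nullary.Decidable using (T?; toWitness; fromWitness)
open import Relation.Binary.Bundles using (Setoid)
open import Relation.Binary.Definitions using (tri<; tri≈; tri>)
open import Relation.Binary.PropositionalEquality
import Relation.Binary.Reasoning.Setoid as SetoidReasoning
open import Algebra.Bundles using (CommutativeRing; Ring)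
open import Algebra.Structures using (IsCommutativeRing)
import Algebra.Properties.CommutativeSemigroup as CommutativeSemigroupProperties
import Algebra.Properties.RingWithoutOne as RingWithoutOneProperties
import Algebra.Properties.AbelianGroup as AbelianGroupProperties

open +-*-Solver using (solve; _:=_; _:+_; _:*_; con)

∈-─⁺ : ∀ {A : Set} {x z : A} {ys} (p : x ∈ ys) → z ∈ ys → z ≢ x → z ∈ ys ─ p
∈-─⁺ (here refl) (here refl) z≢x = ⊥-elim (z≢x refl)
∈-─⁺ (here refl) (there z∈) _   = z∈
∈-─⁺ (there p)   (here refl) _   = here refl
∈-─⁺ (there p)   (there z∈) z≢x = there (∈-─⁺ p z∈ z≢x)

Unique-⊆⇒length≤ : ∀ {A : Set} {xs ys : List A} → Unique xs → xs ⊆ ys → length xs ≤ length ys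
Unique-⊆⇒length≤ {xs = []} _ _ = z≤n
Unique-⊆⇒length≤ {xs = x ∷ xs} {ys} (x∉xs ∷ unique) xs⊆ys =
  subst (suc (length xs) ≤_) (sym (length-removeAt′ ys _))
        (s≤s (Unique-⊆⇒length≤ unique λ z∈ → ∈-─⁺ x∈ys (xs⊆ys (there z∈)) (All.lookup x∉xs z∈ ∘ sym)))
  where
  x∈ys = xs⊆ys (here refl)

length-concatMap : ∀ {A B : Set} (f : A → List B) xs → length (concatMap f xs) ≡ sum (map (length ∘ f) xs)
length-concatMap f []       = refl
length-concatMap f (x ∷ xs) = trans (length-++ (f x)) (cong (length (f x) +_) (length-concatMap f xs))

sum-map-const : ∀ {A : Set} c (xs : List A) → sum (map (λ _ → c) xs) ≡ length xs * c
sum-map-const c []       = refl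
sum-map-const c (x ∷ xs) = cong (c +_) (sum-map-const c xs)

sum-map-≤ : ∀ {A : Set} (f : A → ℕ) {B} xs → (∀ {x} → x ∈ xs → f x ≤ B) → sum (map f xs) ≤ length xs * B
sum-map-≤ f []       _     = z≤n
sum-map-≤ f (x ∷ xs) f≤B = +-mono-≤ (f≤B (here refl)) (sum-map-≤ f xs (f≤B ∘ there))

length-concatMap-≤ : ∀ {A B : Set} (f : A → List B) {b} xs → (∀ {x} → x ∈ xs → length (f x) ≤ b) →
                     length (concatMap f xs) ≤ length xs * b
length-concatMap-≤ f xs f≤b = ≤-trans (≤-reflexive (length-concatMap f xs)) (sum-map-≤ (length ∘ f) xs f≤b)

sum-map-concatMap : ∀ {A B : Set} (h : B → ℕ) (g : A → List B) xs →
                    sum (map h (concatMap g xs)) ≡ sum (map (λ x → sum (map h (g x))) xs)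
sum-map-concatMap h g []       = refl
sum-map-concatMap h g (x ∷ xs) = begin
  sum (map h (g x ++ concatMap g xs))                    ≡⟨ cong sum (map-++ h (g x) (concatMap g xs)) ⟩
  sum (map h (g x) ++ map h (concatMap g xs))            ≡⟨ sum-++ (map h (g x)) _ ⟩
  sum (map h (g x)) + sum (map h (concatMap g xs))       ≡⟨ cong (sum (map h (g x)) +_) (sum-map-concatMap h g xs) ⟩
  sum (map h (g x)) + sum (map (λ y → sum (map h (g y))) xs) ∎
  where open ≡-Reasoning

sum-map-filter : ∀ {A : Set} (p : A → Bool) (h : A → ℕ) xs →
                 sum (map h (filter (T? ∘ p) xs)) ≡ sum (map (λ x → if p x then h x else 0) xs)
sum-map-filter p h []       = refl
sum-map-filter p h (x ∷ xs) with p x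
... | true  = cong (h x +_) (sum-map-filter p h xs)
... | false = sum-map-filter p h xs

sum-applyUpTo-geometric : ∀ (f : ℕ → ℕ) c K → (∀ e → f e ≤ c * 2 ^ (K ∸ e)) →
                          sum (applyUpTo f (suc K)) ≤ c * 2 ^ suc K
sum-applyUpTo-geometric f c zero    f≤ = begin
  f 0 + 0 ≡⟨ +-identityʳ (f 0) ⟩
  f 0     ≤⟨ f≤ 0 ⟩
  c * 1   ≤⟨ *-monoʳ-≤ c (s≤s z≤n) ⟩
  c * 2   ∎
  where open ≤-Reasoning
sum-applyUpTo-geometric f c (suc K) f≤ = begin
  f 0 + sum (applyUpTo (f ∘ suc) (suc K)) ≤⟨ +-mono-≤ (f≤ 0) (sum-applyUpTo-geometric (f ∘ suc) c K (f≤ ∘ suc)) ⟩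
  c * 2 ^ suc K + c * 2 ^ suc K           ≡⟨ solve 2 (λ c x → c :* x :+ c :* x := c :* (x :+ (x :+ con 0))) refl c (2 ^ suc K) ⟩
  c * 2 ^ suc (suc K)                     ∎
  where open ≤-Reasoning

T-not⇒¬T : ∀ {b} → T (not b) → ¬ T b
T-not⇒¬T {false} _ ()

¬T-not⇒T : ∀ {b} → ¬ T (not b) → T b
¬T-not⇒T {false} ¬T = ¬T _
¬T-not⇒T {true}  _  = _

T-all-lookup : ∀ {A : Set} {p : A → Bool} {xs x} → T (all p xs) → x ∈ xs → T (p x)
T-all-lookup {p = p} {xs} all-p = All.lookup (Allₚ.all⁺ p xs all-p)

T-all-counterexample : ∀ {A : Set} (p : A → Bool) xs → ¬ T (all p xs) → Σ A λ x → x ∈ xs × ¬ T (p x)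
T-all-counterexample p xs ¬all = find (¬All⇒Any¬ (T? ∘ p) xs (¬all ∘ Allₚ.all⁻ p))

∈-allVecs : ∀ {q} m (v : Vec (Fin q) m) → v ∈ allVecs q m
∈-allVecs zero    []ᵥ       = here refl
∈-allVecs (suc m) (a ∷ᵥ v) = ∈-concatMap⁺ _ (Any.map (λ { refl → ∈-map⁺ (a ∷ᵥ_) (∈-allVecs m v) }) (∈-allFin a))

allVecs-unique : ∀ q m → Unique (allVecs q m)
allVecs-unique q zero    = All.[] ∷ []
allVecs-unique q (suc m) = Uniqueₚ.concat⁺ (Allₚ.map⁺ (All.universal block-unique _))
                                           (AllPairsₚ.map⁺ (AllPairs.map blocks-disjoint (Uniqueₚ.allFin⁺ q)))
  where
  block-unique : ∀ a → Unique (map (a ∷ᵥ_) (allVecs q m))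
  block-unique a = Uniqueₚ.map⁺ (proj₂ ∘ ∷-injective) (allVecs-unique q m)
  blocks-disjoint : ∀ {a b} → a ≢ b → Disjoint (map (a ∷ᵥ_) (allVecs q m)) (map (b ∷ᵥ_) (allVecs q m))
  blocks-disjoint a≢b (v∈a , v∈b) with ∈-map⁻ _ v∈a | ∈-map⁻ _ v∈b
  ... | _ , _ , refl | _ , _ , refl = a≢b refl

length-allVecs : ∀ q m → length (allVecs q m) ≡ q ^ m
length-allVecs q zero    = refl
length-allVecs q (suc m) = begin
  length (concatMap block (allFin q))       ≡⟨ length-concatMap block (allFin q) ⟩
  sum (map (length ∘ block) (allFin q))     ≡⟨ cong sum (map-cong (λ a → trans (length-map (a ∷ᵥ_) (allVecs q m)) (length-allVecs q m)) (allFin q)) ⟩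
  sum (map (λ _ → q ^ m) (allFin q))        ≡⟨ sum-map-const (q ^ m) (allFin q) ⟩
  length (allFin q) * q ^ m                 ≡⟨ cong (_* q ^ m) (length-tabulate {n = q} id) ⟩
  q * q ^ m                                 ∎
  where
  open ≡-Reasoning
  block = λ a → map (a ∷ᵥ_) (allVecs q m)

^-distribʳ-* : ∀ m n o → (m * n) ^ o ≡ m ^ o * n ^ o
^-distribʳ-* m n zero    = refl
^-distribʳ-* m n (suc o) = trans (cong (m * n *_) (^-distribʳ-* m n o))
  (solve 4 (λ m n x y → (m :* n) :* (x :* y) := (m :* x) :* (n :* y)) refl m n (m ^ o) (n ^ o))

n*m≤o⇒m≤o/n : ∀ m n o .{{_ : NonZero n}} → n * m ≤ o → m ≤ o / n
n*m≤o⇒m≤o/n m n o nm≤o = subst (_≤ o / n) (m*n/n≡m m n) (/-monoˡ-≤ n (subst (_≤ o) (*-comm n m) nm≤o))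

^-upper : ∀ {a b x y} k → a ≤ b * x → x ^ k ≤ y → a ^ k ≤ b ^ k * y
^-upper {a} {b} {x} {y} k a≤bx xᵏ≤y = begin
  a ^ k          ≤⟨ ^-monoˡ-≤ k a≤bx ⟩
  (b * x) ^ k    ≡⟨ ^-distribʳ-* b x k ⟩
  b ^ k * x ^ k  ≤⟨ *-monoʳ-≤ (b ^ k) xᵏ≤y ⟩
  b ^ k * y      ∎
  where open ≤-Reasoning

^-lower : ∀ {q c m} k n .{{_ : NonZero q}} → q ^ m ≤ c → k ≤ n → q ^ (k * suc m) ≤ c ^ k * q ^ n
^-lower {q} {c} {m} k n qᵐ≤c k≤n = begin
  q ^ (k * suc m)       ≡⟨ cong (q ^_) (*-suc k m) ⟩
  q ^ (k + k * m)       ≡⟨ ^-distribˡ-+-* q k (k * m) ⟩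
  q ^ k * q ^ (k * m)   ≡⟨ cong (q ^ k *_) (trans (cong (q ^_) (*-comm k m)) (sym (^-*-assoc q m k))) ⟩
  q ^ k * (q ^ m) ^ k   ≤⟨ *-mono-≤ (^-monoʳ-≤ q k≤n) (^-monoˡ-≤ k qᵐ≤c) ⟩
  q ^ n * c ^ k         ≡⟨ *-comm (q ^ n) (c ^ k) ⟩
  c ^ k * q ^ n         ∎
  where open ≤-Reasoning

n<2^n : ∀ n → n < 2 ^ n
n<2^n zero    = s≤s z≤n
n<2^n (suc n) = begin
  1 + suc n         ≤⟨ +-mono-≤ (m^n>0 2 n) (n<2^n n) ⟩
  2 ^ n + 2 ^ n     ≡⟨ cong (2 ^ n +_) (sym (+-identityʳ (2 ^ n))) ⟩
  2 ^ suc n         ∎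
  where open ≤-Reasoning

n*[1+n]+2≤2^[1+n] : ∀ n → n * suc n + 2 ≤ 2 ^ suc n
n*[1+n]+2≤2^[1+n] zero    = s≤s (s≤s z≤n)
n*[1+n]+2≤2^[1+n] (suc n) = begin
  suc n * suc (suc n) + 2
    ≡⟨ solve 1 (λ n → (con 1 :+ n) :* (con 2 :+ n) :+ con 2 := (n :* (con 1 :+ n) :+ con 2) :+ con 2 :* (con 1 :+ n)) refl n ⟩
  (n * suc n + 2) + 2 * suc n    ≤⟨ +-mono-≤ (n*[1+n]+2≤2^[1+n] n) (*-monoʳ-≤ 2 (n<2^n n)) ⟩
  2 ^ suc n + 2 * 2 ^ n          ≡⟨ cong (2 ^ suc n +_) (sym (+-identityʳ (2 ^ suc n))) ⟩
  2 ^ suc (suc n)                ∎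
  where open ≤-Reasoning

linear≤exp : ∀ b u → 2 * b ≤ u → b * suc u ≤ 2 ^ u
linear≤exp b u 2b≤u = *-cancelˡ-≤ 2 (begin
  2 * (b * suc u)   ≡⟨ sym (*-assoc 2 b (suc u)) ⟩
  2 * b * suc u     ≤⟨ *-monoˡ-≤ (suc u) 2b≤u ⟩
  u * suc u         ≤⟨ m≤m+n (u * suc u) 2 ⟩
  u * suc u + 2     ≤⟨ n*[1+n]+2≤2^[1+n] u ⟩
  2 * 2 ^ u         ∎)
  where open ≤-Reasoning

-- With u = t / c: a (t + 1) ≤ (a c) (u + 1) ≤ 2 ^ u, and u c ≤ t.
polynomial≤exp : ∀ a c t → 2 * (a * c) * c ≤ t → (a * suc t) ^ c ≤ 2 ^ t
polynomial≤exp a zero      t _   = m^n>0 2 t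
polynomial≤exp a c@(suc _) t large = begin
  (a * suc t) ^ c  ≤⟨ ^-monoˡ-≤ c a[1+t]≤2^u ⟩
  (2 ^ u) ^ c      ≡⟨ ^-*-assoc 2 u c ⟩
  2 ^ (u * c)      ≤⟨ ^-monoʳ-≤ 2 (m/n*n≤m t c) ⟩
  2 ^ t            ∎
  where
  open ≤-Reasoning
  u = t / c
  1+t≤c[1+u] : suc t ≤ c * suc u
  1+t≤c[1+u] = begin
    suc t             ≡⟨ cong suc (m≡m%n+[m/n]*n t c) ⟩
    suc (t % c + u * c) ≤⟨ +-monoˡ-≤ (u * c) (m%n<n t c) ⟩
    c + u * c         ≡⟨ *-comm (suc u) c ⟩
    c * suc u         ∎
  a[1+t]≤2^u : a * suc t ≤ 2 ^ u
  a[1+t]≤2^u = begin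
    a * suc t         ≤⟨ *-monoʳ-≤ a 1+t≤c[1+u] ⟩
    a * (c * suc u)   ≡⟨ sym (*-assoc a c (suc u)) ⟩
    a * c * suc u     ≤⟨ linear≤exp (a * c) u (n*m≤o⇒m≤o/n (2 * (a * c)) c t (subst (_≤ t) (*-comm _ c) large)) ⟩
    2 ^ u             ∎

exponent-slack : ∀ c s n → 2 * s ≤ n → 8 * c * c ≤ n → suc n ^ c * 2 ^ s ≤ 2 ^ n
exponent-slack c s n 2s≤n 8cc≤n = begin
  suc n ^ c * 2 ^ s        ≤⟨ *-monoˡ-≤ (2 ^ s) (^-monoˡ-≤ c 1+n≤2[1+t]) ⟩
  (2 * suc t) ^ c * 2 ^ s  ≤⟨ *-monoˡ-≤ (2 ^ s) (polynomial≤exp 2 c t 4cc≤t) ⟩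
  2 ^ t * 2 ^ s            ≡⟨ sym (^-distribˡ-+-* 2 t s) ⟩
  2 ^ (t + s)              ≡⟨ cong (2 ^_) (m∸n+n≡m s≤n) ⟩
  2 ^ n                    ∎
  where
  open ≤-Reasoning
  t = n ∸ s
  s≤n : s ≤ n
  s≤n = ≤-trans (m≤m+n s (s + 0)) 2s≤n
  n≤2t : n ≤ 2 * t
  n≤2t = +-cancelʳ-≤ (2 * s) n (2 * t) (begin
    n + 2 * s      ≤⟨ +-monoʳ-≤ n 2s≤n ⟩
    n + n          ≡⟨ solve 1 (λ n → n :+ n := con 2 :* n) refl n ⟩
    2 * n          ≡⟨ cong (2 *_) (sym (m∸n+n≡m s≤n)) ⟩
    2 * (t + s)    ≡⟨ *-distribˡ-+ 2 t s ⟩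
    2 * t + 2 * s  ∎)
  1+n≤2[1+t] : suc n ≤ 2 * suc t
  1+n≤2[1+t] = ≤-trans (s≤s n≤2t) (≤-trans (n≤1+n _) (≤-reflexive (sym (*-suc 2 t))))
  4cc≤t : 2 * (2 * c) * c ≤ t
  4cc≤t = *-cancelˡ-≤ 2 (≤-trans (≤-reflexive (solve 1 (λ c → con 2 :* (con 2 :* (con 2 :* c) :* c) := con 8 :* c :* c) refl c)) (≤-trans 8cc≤n n≤2t))

polynomial-exponential-slack : ∀ k L M n .{{_ : NonZero L}} → 4 * k ≤ L → 8 * (suc M * k) * (suc M * k) ≤ n →
                               (suc n ^ suc M * 2 ^ (n / L + n / L)) ^ k ≤ 2 ^ n
polynomial-exponential-slack k L M n 4k≤L large = begin
  (suc n ^ suc M * 2 ^ (K + K)) ^ k         ≡⟨ ^-distribʳ-* (suc n ^ suc M) (2 ^ (K + K)) k ⟩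
  (suc n ^ suc M) ^ k * (2 ^ (K + K)) ^ k   ≡⟨ cong₂ _*_ (^-*-assoc (suc n) (suc M) k) (^-*-assoc 2 (K + K) k) ⟩
  suc n ^ (suc M * k) * 2 ^ ((K + K) * k)   ≤⟨ exponent-slack (suc M * k) ((K + K) * k) n 2s≤n large ⟩
  2 ^ n                                     ∎
  where
  open ≤-Reasoning
  K = n / L
  2s≤n : 2 * ((K + K) * k) ≤ n
  2s≤n = begin
    2 * ((K + K) * k) ≡⟨ solve 2 (λ K k → con 2 :* ((K :+ K) :* k) := (con 4 :* k) :* K) refl K k ⟩
    4 * k * K         ≤⟨ *-monoˡ-≤ K 4k≤L ⟩
    L * K             ≡⟨ *-comm L K ⟩
    K * L             ≤⟨ m/n*n≤m n L ⟩
    n                 ∎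

weightedSum : List ℕ → List ℕ → ℕ
weightedSum (δ ∷ δs) (e ∷ es) = e * δ + weightedSum δs es
weightedSum _        _        = 0

exponentVectors : ℕ → List ℕ → ℕ → ℕ → List (List ℕ)
exponentVectors L []       m K = [] ∷ []
exponentVectors L (δ ∷ δs) m K with δ <? L
... | yes _ = concatMap (λ e → map (e ∷_) (exponentVectors L δs m K)) (upTo (suc m))
... | no  _ = concatMap (λ e → map (e ∷_) (exponentVectors L δs m (K ∸ e))) (upTo (suc K))

smallCount : ℕ → List ℕ → ℕ
smallCount L []       = 0
smallCount L (δ ∷ δs) with δ <? L
... | yes _ = suc (smallCount L δs)
... | no  _ = smallCount L δs

largeCount : ℕ → List ℕ → ℕ
largeCount L []       = 0
largeCount L (δ ∷ δs) with δ <? L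
... | yes _ = largeCount L δs
... | no  _ = suc (largeCount L δs)

largeExponentSum : ℕ → List ℕ → List ℕ → ℕ
largeExponentSum L (δ ∷ δs) (e ∷ es) with δ <? L
... | yes _ = largeExponentSum L δs es
... | no  _ = e + largeExponentSum L δs es
largeExponentSum L _ _ = 0

length-exponentVectors : ∀ L δs m K →
  length (exponentVectors L δs m K) ≤ suc m ^ smallCount L δs * 2 ^ (K + largeCount L δs)
length-exponentVectors L []       m K = ≤-trans (m^n>0 2 (K + 0)) (≤-reflexive (sym (*-identityˡ _)))
length-exponentVectors L (δ ∷ δs) m K with δ <? L
... | yes _ = begin
  length (concatMap branch (upTo (suc m)))  ≤⟨ length-concatMap-≤ branch (upTo (suc m)) (λ {e} _ → ≤-reflexive (length-map (e ∷_) rest)) ⟩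
  length (upTo (suc m)) * length rest       ≤⟨ *-mono-≤ (≤-reflexive (length-upTo (suc m))) (length-exponentVectors L δs m K) ⟩
  suc m * (A * B)                           ≡⟨ sym (*-assoc (suc m) A B) ⟩
  suc m ^ suc (smallCount L δs) * B         ∎
  where
  open ≤-Reasoning
  A = suc m ^ smallCount L δs
  B = 2 ^ (K + largeCount L δs)
  rest = exponentVectors L δs m K
  branch = λ e → map (e ∷_) rest
... | no _ = begin
  length (concatMap branch (upTo (suc K)))    ≡⟨ length-concatMap branch (upTo (suc K)) ⟩
  sum (map (length ∘ branch) (upTo (suc K)))  ≡⟨ cong sum (map-applyUpTo id (length ∘ branch) (suc K)) ⟩
  sum (applyUpTo (length ∘ branch) (suc K))   ≤⟨ sum-applyUpTo-geometric (length ∘ branch) c K branch≤ ⟩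
  c * 2 ^ suc K                               ≡⟨ *-assoc A (2 ^ b) (2 ^ suc K) ⟩
  A * (2 ^ b * 2 ^ suc K)                     ≡⟨ cong (A *_) (sym (^-distribˡ-+-* 2 b (suc K))) ⟩
  A * 2 ^ (b + suc K)                         ≡⟨ cong (λ x → A * 2 ^ x) (trans (+-comm b (suc K)) (sym (+-suc K b))) ⟩
  A * 2 ^ (K + suc b)                         ∎
  where
  open ≤-Reasoning
  A = suc m ^ smallCount L δs
  b = largeCount L δs
  c = A * 2 ^ b
  branch = λ e → map (e ∷_) (exponentVectors L δs m (K ∸ e))
  branch≤ : ∀ e → length (branch e) ≤ c * 2 ^ (K ∸ e)
  branch≤ e = begin
    length (branch e)                        ≡⟨ length-map (e ∷_) (exponentVectors L δs m (K ∸ e)) ⟩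
    length (exponentVectors L δs m (K ∸ e))  ≤⟨ length-exponentVectors L δs m (K ∸ e) ⟩
    A * 2 ^ ((K ∸ e) + b)                    ≡⟨ cong (A *_) (trans (^-distribˡ-+-* 2 (K ∸ e) b) (*-comm (2 ^ (K ∸ e)) (2 ^ b))) ⟩
    A * (2 ^ b * 2 ^ (K ∸ e))                ≡⟨ sym (*-assoc A (2 ^ b) _) ⟩
    c * 2 ^ (K ∸ e)                          ∎

∈-exponentVectors : ∀ L δs m K es → All (1 ≤_) δs → length es ≡ length δs →
  weightedSum δs es ≤ m → largeExponentSum L δs es ≤ K → es ∈ exponentVectors L δs m K
∈-exponentVectors L []       m K []       _          _   _    _    = here refl
∈-exponentVectors L (δ ∷ δs) m K (e ∷ es) (1≤δ ∷ 1≤δs) len ws≤m ls≤K with δ <? L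
... | yes _ = ∈-concatMap⁺ _ (Any.map (λ { refl → ∈-map⁺ (e ∷_) rest∈ }) (∈-upTo⁺ (s≤s e≤m)))
  where
  e≤m : e ≤ m
  e≤m = ≤-trans (m≤m*n e δ {{>-nonZero 1≤δ}}) (≤-trans (m≤m+n (e * δ) _) ws≤m)
  rest∈ = ∈-exponentVectors L δs m K es 1≤δs (suc-injective len) (≤-trans (m≤n+m _ (e * δ)) ws≤m) ls≤K
... | no _ = ∈-concatMap⁺ _ (Any.map (λ { refl → ∈-map⁺ (e ∷_) rest∈ }) (∈-upTo⁺ (s≤s (≤-trans (m≤m+n e _) ls≤K))))
  where
  rest∈ = ∈-exponentVectors L δs m (K ∸ e) es 1≤δs (suc-injective len) (≤-trans (m≤n+m _ (e * δ)) ws≤m)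
            (subst (_≤ K ∸ e) (m+n∸m≡n e _) (∸-monoˡ-≤ e ls≤K))

L*largeExponentSum≤weightedSum : ∀ L δs es → L * largeExponentSum L δs es ≤ weightedSum δs es
L*largeExponentSum≤weightedSum L (δ ∷ δs) (e ∷ es) with δ <? L
... | yes _ = ≤-trans (L*largeExponentSum≤weightedSum L δs es) (m≤n+m _ (e * δ))
... | no δ≮L = begin
  L * (e + largeExponentSum L δs es)     ≡⟨ *-distribˡ-+ L e _ ⟩
  L * e + L * largeExponentSum L δs es   ≤⟨ +-mono-≤ (≤-trans (≤-reflexive (*-comm L e)) (*-monoʳ-≤ e (≮⇒≥ δ≮L)))
                                                     (L*largeExponentSum≤weightedSum L δs es) ⟩
  e * δ + weightedSum δs es              ∎
  where open ≤-Reasoning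
L*largeExponentSum≤weightedSum L []       _  = ≤-reflexive (*-zeroʳ L)
L*largeExponentSum≤weightedSum L (_ ∷ _)  [] = ≤-reflexive (*-zeroʳ L)

L*largeCount≤sum : ∀ L δs → L * largeCount L δs ≤ sum δs
L*largeCount≤sum L []       = ≤-reflexive (*-zeroʳ L)
L*largeCount≤sum L (δ ∷ δs) with δ <? L
... | yes _  = ≤-trans (L*largeCount≤sum L δs) (m≤n+m _ δ)
... | no δ≮L = ≤-trans (≤-reflexive (*-suc L _)) (+-mono-≤ (≮⇒≥ δ≮L) (L*largeCount≤sum L δs))

module Polynomials {q : ℕ} (F : FiniteField q) where

  open FiniteField F
  open Poly F
  open IsCommutativeRing isCommutativeRing
    using (zeroˡ; zeroʳ; -‿inverseˡ; -‿inverseʳ; distribˡ; distribʳ)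
    renaming (+-identityˡ to +ᶠ-identityˡ; +-identityʳ to +ᶠ-identityʳ; +-assoc to +ᶠ-assoc; +-comm to +ᶠ-comm;
              *-identityˡ to *ᶠ-identityˡ; *-identityʳ to *ᶠ-identityʳ; *-assoc to *ᶠ-assoc; *-comm to *ᶠ-comm)

  coeff : Pol → ℕ → Fin q
  coeff []      _       = 0ᶠ
  coeff (a ∷ f) zero    = a
  coeff (a ∷ f) (suc i) = coeff f i

  -- Coefficient lists are identified up to trailing zeros.
  infix 4 _≈_
  record _≈_ (f g : Pol) : Set where
    constructor mk≈
    field at : ∀ i → coeff f i ≡ coeff g i
  open _≈_ public

  ≈-setoid : Setoid 0ℓ 0ℓ
  ≈-setoid = record
    { Carrier = Pol
    ; _≈_ = _≈_
    ; isEquivalence = record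
      { refl  = mk≈ λ _ → refl
      ; sym   = λ f≈g → mk≈ λ i → sym (at f≈g i)
      ; trans = λ f≈g g≈h → mk≈ λ i → trans (at f≈g i) (at g≈h i)
      }
    }

  open Setoid ≈-setoid public using () renaming (refl to ≈-refl; sym to ≈-sym; trans to ≈-trans; reflexive to ≈-reflexive)

  tl : Pol → Pol
  tl []      = []
  tl (_ ∷ f) = f

  coeff-tl : ∀ f i → coeff (tl f) i ≡ coeff f (suc i)
  coeff-tl []      i = refl
  coeff-tl (a ∷ f) i = refl

  tl-cong : ∀ {f g} → f ≈ g → tl f ≈ tl g
  tl-cong {f} {g} f≈g = mk≈ λ i → trans (coeff-tl f i) (trans (at f≈g (suc i)) (sym (coeff-tl g i)))

  ∷-cong : ∀ {a b f g} → a ≡ b → f ≈ g → a ∷ f ≈ b ∷ g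
  ∷-cong a≡b f≈g = mk≈ λ { zero → a≡b ; (suc i) → at f≈g i }

  0∷[]≈[] : 0ᶠ ∷ [] ≈ []
  0∷[]≈[] = mk≈ λ { zero → refl ; (suc i) → refl }

  infix 30 _·_
  _·_ : Fin q → Pol → Pol
  a · g = map (a *ᶠ_) g

  neg : Pol → Pol
  neg = map -ᶠ_

  one : Pol
  one = 1ᶠ ∷ []

  coeff-⊕ : ∀ f g i → coeff (f ⊕ g) i ≡ coeff f i +ᶠ coeff g i
  coeff-⊕ []      g       i       = sym (+ᶠ-identityˡ _)
  coeff-⊕ (a ∷ f) []      i       = sym (+ᶠ-identityʳ _)
  coeff-⊕ (a ∷ f) (b ∷ g) zero    = refl
  coeff-⊕ (a ∷ f) (b ∷ g) (suc i) = coeff-⊕ f g i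

  coeff-· : ∀ a g i → coeff (a · g) i ≡ a *ᶠ coeff g i
  coeff-· a []      i       = sym (zeroʳ a)
  coeff-· a (b ∷ g) zero    = refl
  coeff-· a (b ∷ g) (suc i) = coeff-· a g i

  coeff-neg : ∀ g i → coeff (neg g) i ≡ -ᶠ coeff g i
  coeff-neg []      i       = sym (trans (sym (+ᶠ-identityˡ _)) (-‿inverseʳ 0ᶠ))
  coeff-neg (b ∷ g) zero    = refl
  coeff-neg (b ∷ g) (suc i) = coeff-neg g i

  ⊕-cong : ∀ {f f′ g g′} → f ≈ f′ → g ≈ g′ → f ⊕ g ≈ f′ ⊕ g′
  ⊕-cong {f} {f′} {g} {g′} f≈f′ g≈g′ = mk≈ λ i →
    trans (coeff-⊕ f g i) (trans (cong₂ _+ᶠ_ (at f≈f′ i) (at g≈g′ i)) (sym (coeff-⊕ f′ g′ i)))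

  ⊕-congˡ : ∀ {f f′} g → f ≈ f′ → f ⊕ g ≈ f′ ⊕ g
  ⊕-congˡ g f≈f′ = ⊕-cong f≈f′ (≈-refl {g})

  ⊕-congʳ : ∀ f {g g′} → g ≈ g′ → f ⊕ g ≈ f ⊕ g′
  ⊕-congʳ f g≈g′ = ⊕-cong (≈-refl {f}) g≈g′

  ·-cong : ∀ a {g g′} → g ≈ g′ → a · g ≈ a · g′
  ·-cong a {g} {g′} g≈g′ = mk≈ λ i → trans (coeff-· a g i) (trans (cong (a *ᶠ_) (at g≈g′ i)) (sym (coeff-· a g′ i)))

  neg-cong : ∀ {g g′} → g ≈ g′ → neg g ≈ neg g′
  neg-cong {g} {g′} g≈g′ = mk≈ λ i → trans (coeff-neg g i) (trans (cong -ᶠ_ (at g≈g′ i)) (sym (coeff-neg g′ i)))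

  ⊕-comm : ∀ f g → f ⊕ g ≈ g ⊕ f
  ⊕-comm f g = mk≈ λ i → trans (coeff-⊕ f g i) (trans (+ᶠ-comm _ _) (sym (coeff-⊕ g f i)))

  ⊕-assoc : ∀ f g h → (f ⊕ g) ⊕ h ≈ f ⊕ (g ⊕ h)
  ⊕-assoc f g h = mk≈ λ i → begin
    coeff ((f ⊕ g) ⊕ h) i                  ≡⟨ trans (coeff-⊕ (f ⊕ g) h i) (cong (_+ᶠ coeff h i) (coeff-⊕ f g i)) ⟩
    (coeff f i +ᶠ coeff g i) +ᶠ coeff h i  ≡⟨ +ᶠ-assoc _ _ _ ⟩
    coeff f i +ᶠ (coeff g i +ᶠ coeff h i)  ≡⟨ sym (trans (coeff-⊕ f (g ⊕ h) i) (cong (coeff f i +ᶠ_) (coeff-⊕ g h i))) ⟩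
    coeff (f ⊕ (g ⊕ h)) i                  ∎
    where open ≡-Reasoning

  ⊕-identityʳ : ∀ f → f ⊕ [] ≈ f
  ⊕-identityʳ f = mk≈ λ i → trans (coeff-⊕ f [] i) (+ᶠ-identityʳ _)

  neg-inverseˡ : ∀ f → neg f ⊕ f ≈ []
  neg-inverseˡ f = mk≈ λ i → trans (coeff-⊕ (neg f) f i) (trans (cong (_+ᶠ coeff f i) (coeff-neg f i)) (-‿inverseˡ _))

  ⊕-left-comm : ∀ f g h → f ⊕ (g ⊕ h) ≈ g ⊕ (f ⊕ h)
  ⊕-left-comm f g h = ≈-trans (≈-sym (⊕-assoc f g h)) (≈-trans (⊕-congˡ h (⊕-comm f g)) (⊕-assoc g f h))

  ⊕-interchange : ∀ f g h k → (f ⊕ g) ⊕ (h ⊕ k) ≈ (f ⊕ h) ⊕ (g ⊕ k)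
  ⊕-interchange f g h k = ≈-trans (⊕-assoc f g (h ⊕ k)) (≈-trans (⊕-congʳ f (⊕-left-comm g h k)) (≈-sym (⊕-assoc f h (g ⊕ k))))

  ·-distrib-⊕ : ∀ a f g → a · (f ⊕ g) ≈ a · f ⊕ a · g
  ·-distrib-⊕ a f g = mk≈ λ i → begin
    coeff (a · (f ⊕ g)) i                      ≡⟨ trans (coeff-· a (f ⊕ g) i) (cong (a *ᶠ_) (coeff-⊕ f g i)) ⟩
    a *ᶠ (coeff f i +ᶠ coeff g i)              ≡⟨ distribˡ a _ _ ⟩
    (a *ᶠ coeff f i) +ᶠ (a *ᶠ coeff g i)       ≡⟨ sym (trans (coeff-⊕ (a · f) (a · g) i) (cong₂ _+ᶠ_ (coeff-· a f i) (coeff-· a g i))) ⟩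
    coeff (a · f ⊕ a · g) i                    ∎
    where open ≡-Reasoning

  +ᶠ-distrib-· : ∀ a b g → (a +ᶠ b) · g ≈ a · g ⊕ b · g
  +ᶠ-distrib-· a b g = mk≈ λ i → begin
    coeff ((a +ᶠ b) · g) i                     ≡⟨ coeff-· (a +ᶠ b) g i ⟩
    (a +ᶠ b) *ᶠ coeff g i                      ≡⟨ distribʳ (coeff g i) a b ⟩
    (a *ᶠ coeff g i) +ᶠ (b *ᶠ coeff g i)       ≡⟨ sym (trans (coeff-⊕ (a · g) (b · g) i) (cong₂ _+ᶠ_ (coeff-· a g i) (coeff-· b g i))) ⟩
    coeff (a · g ⊕ b · g) i                    ∎
    where open ≡-Reasoning

  ·-assoc : ∀ a b g → a · (b · g) ≈ (a *ᶠ b) · g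
  ·-assoc a b g = mk≈ λ i → trans (coeff-· a (b · g) i)
    (trans (cong (a *ᶠ_) (coeff-· b g i)) (trans (sym (*ᶠ-assoc a b _)) (sym (coeff-· (a *ᶠ b) g i))))

  ·-identityˡ : ∀ g → 1ᶠ · g ≈ g
  ·-identityˡ g = mk≈ λ i → trans (coeff-· 1ᶠ g i) (*ᶠ-identityˡ _)

  ·-zeroˡ : ∀ g → 0ᶠ · g ≈ []
  ·-zeroˡ g = mk≈ λ i → trans (coeff-· 0ᶠ g i) (zeroˡ _)

  ⊛-zeroʳ : ∀ f → f ⊛ [] ≈ []
  ⊛-zeroʳ []      = ≈-refl
  ⊛-zeroʳ (a ∷ f) = ≈-trans (∷-cong refl (⊛-zeroʳ f)) 0∷[]≈[]

  0∷-⊛ : ∀ f g → (0ᶠ ∷ f) ⊛ g ≈ 0ᶠ ∷ (f ⊛ g)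
  0∷-⊛ f g = ⊕-congˡ (0ᶠ ∷ (f ⊛ g)) (·-zeroˡ g)

  ⊛-∷ʳ : ∀ f b g → f ⊛ (b ∷ g) ≈ b · f ⊕ (0ᶠ ∷ (f ⊛ g))
  ⊛-∷ʳ []      b g = ≈-sym 0∷[]≈[]
  ⊛-∷ʳ (a ∷ f) b g = ∷-cong (cong (_+ᶠ 0ᶠ) (*ᶠ-comm a b)) (begin
    a · g ⊕ (f ⊛ (b ∷ g))                ≈⟨ ⊕-congʳ (a · g) (⊛-∷ʳ f b g) ⟩
    a · g ⊕ (b · f ⊕ (0ᶠ ∷ (f ⊛ g)))     ≈⟨ ⊕-left-comm (a · g) (b · f) _ ⟩
    b · f ⊕ (a · g ⊕ (0ᶠ ∷ (f ⊛ g)))     ∎)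
    where open SetoidReasoning ≈-setoid

  ⊛-comm : ∀ f g → f ⊛ g ≈ g ⊛ f
  ⊛-comm []      g = ≈-sym (⊛-zeroʳ g)
  ⊛-comm (a ∷ f) g = ≈-trans (⊕-congʳ (a · g) (∷-cong refl (⊛-comm f g))) (≈-sym (⊛-∷ʳ g a f))

  coeff-⊛-zero : ∀ f g → coeff (f ⊛ g) 0 ≡ coeff f 0 *ᶠ coeff g 0
  coeff-⊛-zero []      g = sym (zeroˡ _)
  coeff-⊛-zero (a ∷ f) g = trans (coeff-⊕ (a · g) _ 0) (trans (+ᶠ-identityʳ _) (coeff-· a g 0))

  coeff-⊛-suc : ∀ f g i → coeff (f ⊛ g) (suc i) ≡ (coeff f 0 *ᶠ coeff g (suc i)) +ᶠ coeff (tl f ⊛ g) i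
  coeff-⊛-suc []      g i = sym (trans (+ᶠ-identityʳ _) (zeroˡ _))
  coeff-⊛-suc (a ∷ f) g i = trans (coeff-⊕ (a · g) _ (suc i)) (cong (_+ᶠ coeff (f ⊛ g) i) (coeff-· a g (suc i)))

  ⊛-congˡ : ∀ {f f′} g → f ≈ f′ → f ⊛ g ≈ f′ ⊛ g
  ⊛-congˡ g f≈f′ = mk≈ (coeffwise g f≈f′)
    where
    coeffwise : ∀ {f f′} g → f ≈ f′ → ∀ i → coeff (f ⊛ g) i ≡ coeff (f′ ⊛ g) i
    coeffwise {f} {f′} g f≈f′ zero    = trans (coeff-⊛-zero f g)
      (trans (cong (_*ᶠ coeff g 0) (at f≈f′ 0)) (sym (coeff-⊛-zero f′ g)))
    coeffwise {f} {f′} g f≈f′ (suc i) = trans (coeff-⊛-suc f g i)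
      (trans (cong₂ _+ᶠ_ (cong (_*ᶠ coeff g (suc i)) (at f≈f′ 0)) (coeffwise g (tl-cong f≈f′) i)) (sym (coeff-⊛-suc f′ g i)))

  ⊛-congʳ : ∀ f {g g′} → g ≈ g′ → f ⊛ g ≈ f ⊛ g′
  ⊛-congʳ f {g} {g′} g≈g′ = ≈-trans (⊛-comm f g) (≈-trans (⊛-congˡ f g≈g′) (⊛-comm g′ f))

  ⊛-cong : ∀ {f f′ g g′} → f ≈ f′ → g ≈ g′ → f ⊛ g ≈ f′ ⊛ g′
  ⊛-cong {f} {f′} {g} f≈f′ g≈g′ = ≈-trans (⊛-congˡ g f≈f′) (⊛-congʳ f′ g≈g′)

  ⊛-distribʳ : ∀ h f g → (f ⊕ g) ⊛ h ≈ (f ⊛ h) ⊕ (g ⊛ h)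
  ⊛-distribʳ h []      g       = ≈-refl
  ⊛-distribʳ h (a ∷ f) []      = ≈-sym (⊕-identityʳ _)
  ⊛-distribʳ h (a ∷ f) (b ∷ g) = begin
    (a +ᶠ b) · h ⊕ (0ᶠ ∷ ((f ⊕ g) ⊛ h))
      ≈⟨ ⊕-cong (+ᶠ-distrib-· a b h) (∷-cong (sym (+ᶠ-identityʳ 0ᶠ)) (⊛-distribʳ h f g)) ⟩
    (a · h ⊕ b · h) ⊕ ((0ᶠ ∷ (f ⊛ h)) ⊕ (0ᶠ ∷ (g ⊛ h)))
      ≈⟨ ⊕-interchange (a · h) (b · h) _ _ ⟩
    (a · h ⊕ (0ᶠ ∷ (f ⊛ h))) ⊕ (b · h ⊕ (0ᶠ ∷ (g ⊛ h))) ∎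
    where open SetoidReasoning ≈-setoid

  ·-⊛ : ∀ a f g → (a · f) ⊛ g ≈ a · (f ⊛ g)
  ·-⊛ a []      g = ≈-refl
  ·-⊛ a (b ∷ f) g = begin
    (a *ᶠ b) · g ⊕ (0ᶠ ∷ ((a · f) ⊛ g))      ≈⟨ ⊕-cong (≈-sym (·-assoc a b g)) (∷-cong (sym (zeroʳ a)) (·-⊛ a f g)) ⟩
    a · (b · g) ⊕ a · (0ᶠ ∷ (f ⊛ g))          ≈⟨ ≈-sym (·-distrib-⊕ a (b · g) _) ⟩
    a · (b · g ⊕ (0ᶠ ∷ (f ⊛ g)))              ∎
    where open SetoidReasoning ≈-setoid

  ·-⊛ʳ : ∀ a f g → a · (f ⊛ g) ≈ f ⊛ (a · g)
  ·-⊛ʳ a f g = ≈-trans (·-cong a (⊛-comm f g)) (≈-trans (≈-sym (·-⊛ a g f)) (⊛-comm (a · g) f))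

  ⊛-assoc : ∀ f g h → (f ⊛ g) ⊛ h ≈ f ⊛ (g ⊛ h)
  ⊛-assoc []      g h = ≈-refl
  ⊛-assoc (a ∷ f) g h = begin
    (a · g ⊕ (0ᶠ ∷ (f ⊛ g))) ⊛ h              ≈⟨ ⊛-distribʳ h (a · g) _ ⟩
    ((a · g) ⊛ h) ⊕ ((0ᶠ ∷ (f ⊛ g)) ⊛ h)      ≈⟨ ⊕-cong (·-⊛ a g h) (0∷-⊛ (f ⊛ g) h) ⟩
    a · (g ⊛ h) ⊕ (0ᶠ ∷ ((f ⊛ g) ⊛ h))        ≈⟨ ⊕-congʳ (a · (g ⊛ h)) (∷-cong refl (⊛-assoc f g h)) ⟩
    a · (g ⊛ h) ⊕ (0ᶠ ∷ (f ⊛ (g ⊛ h)))        ∎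
    where open SetoidReasoning ≈-setoid

  ⊛-identityˡ : ∀ g → one ⊛ g ≈ g
  ⊛-identityˡ g = ≈-trans (⊕-cong (·-identityˡ g) 0∷[]≈[]) (⊕-identityʳ g)

  ⊛-identityʳ : ∀ f → f ⊛ one ≈ f
  ⊛-identityʳ f = ≈-trans (⊛-comm f one) (⊛-identityˡ f)

  ⊛-distribˡ : ∀ h f g → h ⊛ (f ⊕ g) ≈ (h ⊛ f) ⊕ (h ⊛ g)
  ⊛-distribˡ h f g = ≈-trans (⊛-comm h (f ⊕ g)) (≈-trans (⊛-distribʳ h f g) (⊕-cong (⊛-comm f h) (⊛-comm g h)))

  Pol-isCommutativeRing : IsCommutativeRing _≈_ _⊕_ _⊛_ neg [] one
  Pol-isCommutativeRing = record
    { isRing = record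
      { +-isAbelianGroup = record
        { isGroup = record
          { isMonoid = record
            { isSemigroup = record
              { isMagma = record { isEquivalence = Setoid.isEquivalence ≈-setoid ; ∙-cong = ⊕-cong }
              ; assoc = ⊕-assoc
              }
            ; identity = (λ _ → ≈-refl) , ⊕-identityʳ
            }
          ; inverse = neg-inverseˡ , λ f → ≈-trans (⊕-comm f (neg f)) (neg-inverseˡ f)
          ; ⁻¹-cong = neg-cong
          }
        ; comm = ⊕-comm
        }
      ; *-cong = ⊛-cong
      ; *-assoc = ⊛-assoc
      ; *-identity = ⊛-identityˡ , ⊛-identityʳ
      ; distrib = ⊛-distribˡ , ⊛-distribʳ
      }
    ; *-comm = ⊛-comm
    }

  Pol-commutativeRing : CommutativeRing 0ℓ 0ℓ
  Pol-commutativeRing = record { isCommutativeRing = Pol-isCommutativeRing }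

  module ⊕-Semigroup = CommutativeSemigroupProperties (CommutativeRing.+-commutativeSemigroup Pol-commutativeRing)
  module ⊛-Semigroup = CommutativeSemigroupProperties (CommutativeRing.*-commutativeSemigroup Pol-commutativeRing)
  open RingWithoutOneProperties (Ring.ringWithoutOne (CommutativeRing.ring Pol-commutativeRing)) using (x[y-z]≈xy-xz; [y-z]x≈yx-zx)
  open AbelianGroupProperties (CommutativeRing.+-abelianGroup Pol-commutativeRing) using (xyx⁻¹≈y)

  record Deg< (m : ℕ) (f : Pol) : Set where
    constructor mkDeg<
    field vanish : ∀ i → m ≤ i → coeff f i ≡ 0ᶠ
  open Deg< public

  deg<-length : ∀ f → Deg< (length f) f
  deg<-length f = mkDeg< (beyond-length f)
    where
    beyond-length : ∀ f i → length f ≤ i → coeff f i ≡ 0ᶠ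
    beyond-length []      i       _         = refl
    beyond-length (a ∷ f) (suc i) (s≤s f≤i) = beyond-length f i f≤i

  deg<-mono : ∀ {m m′ f} → m ≤ m′ → Deg< m f → Deg< m′ f
  deg<-mono m≤m′ d = mkDeg< λ i m′≤i → vanish d i (≤-trans m≤m′ m′≤i)

  deg<-resp-≈ : ∀ {m f g} → f ≈ g → Deg< m f → Deg< m g
  deg<-resp-≈ f≈g d = mkDeg< λ i m≤i → trans (sym (at f≈g i)) (vanish d i m≤i)

  deg<-· : ∀ {m f} a → Deg< m f → Deg< m (a · f)
  deg<-· {f = f} a df = mkDeg< λ i m≤i → trans (coeff-· a f i) (trans (cong (a *ᶠ_) (vanish df i m≤i)) (zeroʳ a))

  deg<-tl : ∀ {m f} → Deg< (suc m) f → Deg< m (tl f)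
  deg<-tl {f = f} d = mkDeg< λ i m≤i → trans (coeff-tl f i) (vanish d (suc i) (s≤s m≤i))

  deg<-zero⇒≈[] : ∀ {f} → Deg< 0 f → f ≈ []
  deg<-zero⇒≈[] d = mk≈ λ i → vanish d i z≤n

  deg<-one⇒⊛≈· : ∀ {f} g → Deg< 1 f → f ⊛ g ≈ coeff f 0 · g
  deg<-one⇒⊛≈· {f} g d = mk≈ λ
    { zero    → trans (coeff-⊛-zero f g) (sym (coeff-· _ g 0))
    ; (suc i) → trans (coeff-⊛-suc f g i)
        (trans (cong ((coeff f 0 *ᶠ coeff g (suc i)) +ᶠ_) (at (⊛-congˡ g (deg<-zero⇒≈[] (deg<-tl d))) i))
        (trans (+ᶠ-identityʳ _) (sym (coeff-· _ g (suc i)))))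
    }

  coeff-⊛-top : ∀ a b {f g} → Deg< (suc a) f → Deg< (suc b) g → coeff (f ⊛ g) (a + b) ≡ coeff f a *ᶠ coeff g b
  coeff-⊛-top zero    b {f} {g} df dg = trans (at (deg<-one⇒⊛≈· g df) b) (coeff-· _ g b)
  coeff-⊛-top (suc a) b {f} {g} df dg = begin
    coeff (f ⊛ g) (suc (a + b))                                          ≡⟨ coeff-⊛-suc f g (a + b) ⟩
    (coeff f 0 *ᶠ coeff g (suc (a + b))) +ᶠ coeff (tl f ⊛ g) (a + b)     ≡⟨ cong₂ _+ᶠ_ g-vanishes (coeff-⊛-top a b (deg<-tl df) dg) ⟩
    0ᶠ +ᶠ (coeff (tl f) a *ᶠ coeff g b)                                   ≡⟨ trans (+ᶠ-identityˡ _) (cong (_*ᶠ coeff g b) (coeff-tl f a)) ⟩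
    coeff f (suc a) *ᶠ coeff g b                                          ∎
    where
    open ≡-Reasoning
    g-vanishes = trans (cong (coeff f 0 *ᶠ_) (vanish dg _ (s≤s (m≤n+m b a)))) (zeroʳ _)

  deg<-⊛ : ∀ a b {f g} → Deg< (suc a) f → Deg< (suc b) g → Deg< (suc (a + b)) (f ⊛ g)
  deg<-⊛ zero    b {f} {g} df dg = deg<-resp-≈ (≈-sym (deg<-one⇒⊛≈· g df)) (deg<-· _ dg)
  deg<-⊛ (suc a) b {f} {g} df dg = mkDeg< λ
    { (suc i) (s≤s a+b<i) → begin
        coeff (f ⊛ g) (suc i)                                   ≡⟨ coeff-⊛-suc f g i ⟩
        (coeff f 0 *ᶠ coeff g (suc i)) +ᶠ coeff (tl f ⊛ g) i     ≡⟨ cong₂ _+ᶠ_ (g-vanishes i a+b<i) (vanish (deg<-⊛ a b (deg<-tl df) dg) i a+b<i) ⟩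
        0ᶠ +ᶠ 0ᶠ                                                ≡⟨ +ᶠ-identityʳ 0ᶠ ⟩
        0ᶠ                                                      ∎ }
    where
    open ≡-Reasoning
    g-vanishes : ∀ i → suc (a + b) ≤ i → coeff f 0 *ᶠ coeff g (suc i) ≡ 0ᶠ
    g-vanishes i a+b<i = trans (cong (coeff f 0 *ᶠ_) (vanish dg _ (s≤s (≤-trans (m≤n+m b (suc a)) a+b<i)))) (zeroʳ _)

  Monic : ℕ → Pol → Set
  Monic m f = coeff f m ≡ 1ᶠ × Deg< (suc m) f

  monic-resp-≈ : ∀ {m f g} → f ≈ g → Monic m f → Monic m g
  monic-resp-≈ f≈g (lead , d) = trans (sym (at f≈g _)) lead , deg<-resp-≈ f≈g d

  monic-⊛ : ∀ {a b f g} → Monic a f → Monic b g → Monic (a + b) (f ⊛ g)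
  monic-⊛ {a} {b} (lead-f , df) (lead-g , dg) =
    trans (coeff-⊛-top a b df dg) (trans (cong₂ _*ᶠ_ lead-f lead-g) (*ᶠ-identityˡ 1ᶠ)) , deg<-⊛ a b df dg

  monic-one : Monic 0 one
  monic-one = refl , mkDeg< λ { (suc i) _ → refl }

  monic⇒≉[] : ∀ {m f} → Monic m f → ¬ f ≈ []
  monic⇒≉[] (lead , _) f≈[] = 0≢1 (trans (sym (at f≈[] _)) lead)

  monic-zero⇒≈one : ∀ {f} → Monic 0 f → f ≈ one
  monic-zero⇒≈one (lead , d) = mk≈ λ { zero → lead ; (suc i) → vanish d (suc i) (s≤s z≤n) }

  monic⇒deg< : ∀ {t f n} → Monic t f → Deg< n f → t < n
  monic⇒deg< {t} {f} {n} (lead , _) d with suc t ≤? n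
  ... | yes t<n = t<n
  ... | no  t≮n = ⊥-elim (0≢1 (trans (sym (vanish d t (≤-pred (≰⇒> t≮n)))) lead))

  monic-degree-unique : ∀ {a b f} → Monic a f → Monic b f → a ≡ b
  monic-degree-unique {a} {b} ma mb with <-cmp a b
  ... | tri< a<b _ _ = ⊥-elim (0≢1 (trans (sym (vanish (proj₂ ma) b a<b)) (proj₁ mb)))
  ... | tri≈ _ a≡b _ = a≡b
  ... | tri> _ _ b<a = ⊥-elim (0≢1 (trans (sym (vanish (proj₂ mb) a b<a)) (proj₁ ma)))

  Monic-monic : ∀ {m} (v : Vec (Fin q) m) → Monic m (monic v)
  Monic-monic []ᵥ       = monic-one
  Monic-monic (a ∷ᵥ v) with Monic-monic v
  ... | lead , d = lead , mkDeg< λ { (suc i) (s≤s m≤i) → vanish d i m≤i }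

  monic-injective : ∀ {m} (v w : Vec (Fin q) m) → monic v ≈ monic w → v ≡ w
  monic-injective []ᵥ       []ᵥ       _   = refl
  monic-injective (a ∷ᵥ v) (b ∷ᵥ w) v≈w = cong₂ _∷ᵥ_ (at v≈w 0) (monic-injective v w (tl-cong v≈w))

  lowerCoeffs : (m : ℕ) → Pol → Vec (Fin q) m
  lowerCoeffs zero    f = []ᵥ
  lowerCoeffs (suc m) f = coeff f 0 ∷ᵥ lowerCoeffs m (tl f)

  monic-lowerCoeffs : ∀ m {f} → Monic m f → monic (lowerCoeffs m f) ≈ f
  monic-lowerCoeffs zero    mf = ≈-sym (monic-zero⇒≈one mf)
  monic-lowerCoeffs (suc m) {f} (lead , d) = mk≈ λ
    { zero    → refl
    ; (suc i) → trans (at (monic-lowerCoeffs m (trans (coeff-tl f m) lead , deg<-tl d)) i) (coeff-tl f i) }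

  infixl 20 _⊖_
  _⊖_ : Pol → Pol → Pol
  f ⊖ g = f ⊕ neg g

  coeff-⊖ : ∀ f g i → coeff (f ⊖ g) i ≡ coeff f i +ᶠ (-ᶠ coeff g i)
  coeff-⊖ f g i = trans (coeff-⊕ f (neg g) i) (cong (coeff f i +ᶠ_) (coeff-neg g i))

  ⊖-congˡ : ∀ {f f′} g → f ≈ f′ → f ⊖ g ≈ f′ ⊖ g
  ⊖-congˡ g f≈f′ = ⊕-congˡ (neg g) f≈f′

  ⊖-⊕-cancel : ∀ f g → (f ⊖ g) ⊕ g ≈ f
  ⊖-⊕-cancel f g = ≈-trans (⊕-assoc f (neg g) g) (≈-trans (⊕-congʳ f (neg-inverseˡ g)) (⊕-identityʳ f))

  infix 40 X^_
  X^_ : ℕ → Pol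
  X^ zero  = one
  X^ suc j = 0ᶠ ∷ X^ j

  monic-X^ : ∀ j → Monic j (X^ j)
  monic-X^ zero    = monic-one
  monic-X^ (suc j) with monic-X^ j
  ... | lead , d = lead , mkDeg< λ { (suc i) (s≤s j≤i) → vanish d i j≤i }

  record Division (d f : Pol) (m : ℕ) : Set where
    constructor division
    field
      quotient remainder : Pol
      division-eqn : f ≈ (d ⊛ quotient) ⊕ remainder
      remainder-deg : Deg< m remainder

  trivial-division : ∀ {m d f} → Deg< m f → Division d f m
  trivial-division {d = d} {f} df = division [] f (≈-sym (⊕-congˡ f (⊛-zeroʳ d))) df

  cancel-leading-term : ∀ {m ℓ d f} → Monic m d → m ≤ ℓ → Deg< (suc ℓ) f →
                        Deg< ℓ (f ⊖ (d ⊛ (coeff f ℓ · X^ (ℓ ∸ m))))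
  cancel-leading-term {m} {ℓ} {d} {f} monic-d m≤ℓ f<1+ℓ = mkDeg< λ i ℓ≤i →
    trans (coeff-⊖ f t i) (trans (cong (λ a → a +ᶠ (-ᶠ coeff t i)) (same-top i ℓ≤i)) (-‿inverseʳ (coeff t i)))
    where
    c = coeff f ℓ
    t = d ⊛ (c · X^ (ℓ ∸ m))
    monic-dX : Monic ℓ (d ⊛ X^ (ℓ ∸ m))
    monic-dX = subst (λ k → Monic k (d ⊛ X^ (ℓ ∸ m))) (m+[n∸m]≡n m≤ℓ) (monic-⊛ monic-d (monic-X^ (ℓ ∸ m)))
    t≈c·dX : t ≈ c · (d ⊛ X^ (ℓ ∸ m))
    t≈c·dX = ≈-sym (·-⊛ʳ c d (X^ (ℓ ∸ m)))
    t<1+ℓ : Deg< (suc ℓ) t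
    t<1+ℓ = deg<-resp-≈ (≈-sym t≈c·dX) (deg<-· c (proj₂ monic-dX))
    same-top : ∀ i → ℓ ≤ i → coeff f i ≡ coeff t i
    same-top i ℓ≤i with m≤n⇒m<n∨m≡n ℓ≤i
    ... | inj₁ ℓ<i = trans (vanish f<1+ℓ i ℓ<i) (sym (vanish t<1+ℓ i ℓ<i))
    ... | inj₂ refl = sym (trans (at t≈c·dX ℓ) (trans (coeff-· c (d ⊛ X^ (ℓ ∸ m)) ℓ) (trans (cong (c *ᶠ_) (proj₁ monic-dX)) (*ᶠ-identityʳ c))))

  division-step : ∀ {m d f} t → Division d (f ⊖ (d ⊛ t)) m → Division d f m
  division-step {d = d} {f} t (division Q R eqn R<m) = division (Q ⊕ t) R eqn′ R<m
    where
    open SetoidReasoning ≈-setoid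
    eqn′ : f ≈ (d ⊛ (Q ⊕ t)) ⊕ R
    eqn′ = begin
      f                              ≈⟨ ≈-sym (⊖-⊕-cancel f (d ⊛ t)) ⟩
      (f ⊖ (d ⊛ t)) ⊕ (d ⊛ t)        ≈⟨ ⊕-congˡ (d ⊛ t) eqn ⟩
      ((d ⊛ Q) ⊕ R) ⊕ (d ⊛ t)        ≈⟨ ⊕-Semigroup.xy∙z≈xz∙y (d ⊛ Q) R (d ⊛ t) ⟩
      ((d ⊛ Q) ⊕ (d ⊛ t)) ⊕ R        ≈⟨ ⊕-congˡ R (≈-sym (⊛-distribˡ d Q t)) ⟩
      (d ⊛ (Q ⊕ t)) ⊕ R              ∎

  divide : ∀ {m d} → Monic m d → ∀ f → Division d f m
  divide {m} {d} md f = go (length f) f (deg<-length f)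
    where
    go : ∀ ℓ f → Deg< ℓ f → Division d f m
    go zero    f df = trivial-division (deg<-mono z≤n df)
    go (suc ℓ) f df with suc ℓ ≤? m
    ... | yes ℓ<m = trivial-division (deg<-mono ℓ<m df)
    ... | no  ℓ≮m = division-step t (go ℓ (f ⊖ (d ⊛ t)) (cancel-leading-term md (≤-pred (≰⇒> ℓ≮m)) df))
      where t = coeff f ℓ · X^ (ℓ ∸ m)

  ≈[]? : ∀ f → Dec (f ≈ [])
  ≈[]? []      = yes ≈-refl
  ≈[]? (a ∷ f) with a ≟F 0ᶠ | ≈[]? f
  ... | yes a≡0 | yes f≈[] = yes (≈-trans (∷-cong a≡0 f≈[]) 0∷[]≈[])
  ... | yes _   | no  f≉[] = no λ a∷f≈[] → f≉[] (tl-cong a∷f≈[])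
  ... | no  a≢0 | _        = no λ a∷f≈[] → a≢0 (at a∷f≈[] 0)

  record Lead (f : Pol) : Set where
    constructor lead
    field
      degree       : ℕ
      leading≢0    : coeff f degree ≢ 0ᶠ
      degree-bound : Deg< (suc degree) f
  open Lead

  leading : ∀ f → ¬ f ≈ [] → Lead f
  leading []      f≉[] = ⊥-elim (f≉[] ≈-refl)
  leading (a ∷ f) a∷f≉[] with ≈[]? f
  ... | yes f≈[] = lead 0 (λ a≡0 → a∷f≉[] (≈-trans (∷-cong a≡0 f≈[]) 0∷[]≈[])) (mkDeg< λ { (suc i) _ → at f≈[] i })
  ... | no  f≉[] with leading f f≉[]
  ...   | lead t ≢0 d = lead (suc t) ≢0 (mkDeg< λ { (suc i) (s≤s t<i) → vanish d i t<i })

  lead-resp-≈ : ∀ {f g} → f ≈ g → Lead f → Lead g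
  lead-resp-≈ f≈g (lead t ≢0 d) = lead t (≢0 ∘ trans (at f≈g t)) (deg<-resp-≈ f≈g d)

  coeff-monic-⊛-lead : ∀ {t g f} → Monic t g → (L : Lead f) → coeff (g ⊛ f) (t + degree L) ≡ coeff f (degree L)
  coeff-monic-⊛-lead {t} (one-g , dg) (lead s _ df) = trans (coeff-⊛-top t s dg df) (trans (cong (_*ᶠ _) one-g) (*ᶠ-identityˡ _))

  monic-⊛-lead : ∀ {t g f} → Monic t g → Lead f → Lead (g ⊛ f)
  monic-⊛-lead {t} mg L@(lead s ≢0 df) = lead (t + s) (≢0 ∘ trans (sym (coeff-monic-⊛-lead mg L))) (deg<-⊛ t s (proj₂ mg) df)

  lead-degree-monic : ∀ {m f} → Monic m f → (L : Lead f) → degree L ≡ m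
  lead-degree-monic {m} (one-f , df) (lead s ≢0 ds) with <-cmp s m
  ... | tri< s<m _ _ = ⊥-elim (0≢1 (trans (sym (vanish ds m s<m)) one-f))
  ... | tri≈ _ s≡m _ = s≡m
  ... | tri> _ _ m<s = ⊥-elim (≢0 (vanish df s m<s))

  monic-cofactor : ∀ {t m C Q P} → Monic t C → Monic m P → C ⊛ Q ≈ P → t ≤ m × Monic (m ∸ t) Q
  monic-cofactor {t} {m} {C} {Q} {P} mC mP CQ≈P with ≈[]? Q
  ... | yes Q≈[] = ⊥-elim (monic⇒≉[] mP (≈-trans (≈-sym CQ≈P) (≈-trans (⊛-congʳ C Q≈[]) (⊛-zeroʳ C))))
  ... | no  Q≉[] = ≤-trans (m≤m+n t s) (≤-reflexive t+s≡m) , subst (λ k → Monic k Q) s≡m∸t (one-Q , degree-bound L)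
    where
    L = leading Q Q≉[]
    s = degree L
    t+s≡m : t + s ≡ m
    t+s≡m = lead-degree-monic mP (lead-resp-≈ CQ≈P (monic-⊛-lead mC L))
    s≡m∸t : s ≡ m ∸ t
    s≡m∸t = sym (trans (cong (_∸ t) (sym t+s≡m)) (m+n∸m≡n t s))
    one-Q : coeff Q s ≡ 1ᶠ
    one-Q = trans (sym (coeff-monic-⊛-lead mC L)) (trans (at CQ≈P (t + s)) (trans (cong (coeff P) t+s≡m) (proj₁ mP)))

  infix 4 _∣_
  record _∣_ (P X : Pol) : Set where
    constructor dvd
    field
      cofactor : Pol
      cofactor-eqn : X ≈ P ⊛ cofactor

  ∣-resp-≈ʳ : ∀ {P X X′} → X ≈ X′ → P ∣ X → P ∣ X′
  ∣-resp-≈ʳ X≈X′ (dvd Y X≈PY) = dvd Y (≈-trans (≈-sym X≈X′) X≈PY)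

  ∣-⊛ʳ : ∀ {P X} Z → P ∣ X → P ∣ X ⊛ Z
  ∣-⊛ʳ {P} Z (dvd Y X≈PY) = dvd (Y ⊛ Z) (≈-trans (⊛-congˡ Z X≈PY) (⊛-assoc P Y Z))

  ∣-⊛ˡ : ∀ {P X} Z → P ∣ X → P ∣ Z ⊛ X
  ∣-⊛ˡ {X = X} Z P∣X = ∣-resp-≈ʳ (⊛-comm X Z) (∣-⊛ʳ Z P∣X)

  ∣-self-⊛ : ∀ P Z → P ∣ P ⊛ Z
  ∣-self-⊛ P Z = dvd Z ≈-refl

  ∣-refl : ∀ P → P ∣ P
  ∣-refl P = dvd one (≈-sym (⊛-identityʳ P))

  ∣-trans : ∀ {P X Z} → P ∣ X → X ∣ Z → P ∣ Z
  ∣-trans P∣X (dvd Y Z≈XY) = ∣-resp-≈ʳ (≈-sym Z≈XY) (∣-⊛ʳ Y P∣X)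

  ∣-⊖ : ∀ {P X Y} → P ∣ X → P ∣ Y → P ∣ X ⊖ Y
  ∣-⊖ {P} (dvd U X≈PU) (dvd V Y≈PV) =
    dvd (U ⊖ V) (≈-trans (⊕-cong X≈PU (neg-cong Y≈PV)) (≈-sym (x[y-z]≈xy-xz P U V)))

  ∣-· : ∀ {P X} a → P ∣ X → P ∣ a · X
  ∣-· {P} a (dvd Y X≈PY) = dvd (a · Y) (≈-trans (·-cong a X≈PY) (·-⊛ʳ a P Y))

  ∣-⊛-remainder : ∀ {P A X Q R B} → A ≈ (X ⊛ Q) ⊕ R → P ∣ A ⊛ B → P ∣ X ⊛ B → P ∣ R ⊛ B
  ∣-⊛-remainder {P} {A} {X} {Q} {R} {B} A≈XQ+R P∣AB P∣XB =
    ∣-resp-≈ʳ RB≈AB-XBQ (∣-⊖ P∣AB (∣-⊛ʳ Q P∣XB))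
    where
    open SetoidReasoning ≈-setoid
    RB≈AB-XBQ : (A ⊛ B) ⊖ ((X ⊛ B) ⊛ Q) ≈ R ⊛ B
    RB≈AB-XBQ = begin
      (A ⊛ B) ⊖ ((X ⊛ B) ⊛ Q)                  ≈⟨ ⊕-congʳ (A ⊛ B) (neg-cong (⊛-Semigroup.xy∙z≈xz∙y X B Q)) ⟩
      (A ⊛ B) ⊖ ((X ⊛ Q) ⊛ B)                  ≈⟨ ≈-sym ([y-z]x≈yx-zx B A (X ⊛ Q)) ⟩
      (A ⊖ (X ⊛ Q)) ⊛ B                        ≈⟨ ⊛-congˡ B (⊖-congˡ (X ⊛ Q) A≈XQ+R) ⟩
      (((X ⊛ Q) ⊕ R) ⊖ (X ⊛ Q)) ⊛ B            ≈⟨ ⊛-congˡ B (xyx⁻¹≈y (X ⊛ Q) R) ⟩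
      R ⊛ B                                    ∎

  division⇒∣ : ∀ {P A Q R} → A ≈ (P ⊛ Q) ⊕ R → R ≈ [] → P ∣ A
  division⇒∣ {P} {Q = Q} A≈PQ+R R≈[] = dvd Q (≈-trans A≈PQ+R (≈-trans (⊕-congʳ (P ⊛ Q) R≈[]) (⊕-identityʳ (P ⊛ Q))))

  monicize : ∀ f → ¬ f ≈ [] → Σ ℕ λ t → Σ (Fin q) λ y → Monic t (y · f)
  monicize f f≉[] with leading f f≉[]
  ... | lead t ≢0 d with inverse (coeff f t) ≢0
  ...   | y , fy≡1 = t , y , trans (coeff-· y f t) (trans (*ᶠ-comm y _) fy≡1) , deg<-· y d

  record Irreducible (m : ℕ) (P : Pol) : Set where
    field
      monic-irreducible : Monic m P
      positive-degree   : 1 ≤ m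
      no-proper-factor  : ∀ {a A B} → Monic a A → 1 ≤ a → a < m → A ⊛ B ≈ P → ⊥
  open Irreducible public

  small-monic-factor≈one : ∀ {m P t X Q} → Irreducible m P → Monic t X → t < m → X ⊛ Q ≈ P → X ≈ one
  small-monic-factor≈one {t = zero}  irr mX _   _    = monic-zero⇒≈one mX
  small-monic-factor≈one {t = suc t} irr mX t<m XQ≈P = ⊥-elim (no-proper-factor irr mX (s≤s z≤n) t<m XQ≈P)

  -- Induction on a degree bound for C: dividing P by the monic multiple y C either leaves a
  -- nonzero remainder R of smaller degree with P ∣ R B, or shows y C ∣ P, whence y C ≈ one.
  euclid-small : ∀ {m P} → Irreducible m P → ∀ n C B → Deg< n C → ¬ C ≈ [] → n ≤ m → P ∣ C ⊛ B → P ∣ B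
  euclid-small irr zero    C B C<n C≉[] _ _ = ⊥-elim (C≉[] (deg<-zero⇒≈[] C<n))
  euclid-small {m} {P} irr (suc n) C B C<n C≉[] n≤m P∣CB with monicize C C≉[]
  ... | t , y , monic-yC = reduce (divide monic-yC P)
    where
    t<1+n : t < suc n
    t<1+n = monic⇒deg< monic-yC (deg<-· y C<n)
    P∣yCB : P ∣ (y · C) ⊛ B
    P∣yCB = ∣-resp-≈ʳ (≈-sym (·-⊛ y C B)) (∣-· y P∣CB)
    reduce : Division (y · C) P t → P ∣ B
    reduce (division Q R P≈yCQ+R R<t) with ≈[]? R
    ... | no  R≉[] = euclid-small irr n R B (deg<-mono (≤-pred t<1+n) R<t) R≉[] (≤-trans (n≤1+n n) n≤m)
                       (∣-⊛-remainder {X = y · C} P≈yCQ+R (∣-self-⊛ P B) P∣yCB)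
    ... | yes R≈[] = ∣-resp-≈ʳ (≈-trans (⊛-congˡ B yC≈one) (⊛-identityˡ B)) P∣yCB
      where
      yC≈one = small-monic-factor≈one irr monic-yC (<-≤-trans t<1+n n≤m)
                 (≈-sym (_∣_.cofactor-eqn (division⇒∣ {P = y · C} P≈yCQ+R R≈[])))

  euclid : ∀ {m P} → Irreducible m P → ∀ A B → P ∣ A ⊛ B → P ∣ A ⊎ P ∣ B
  euclid {m} {P} irr A B P∣AB with divide (monic-irreducible irr) A
  ... | division Q R A≈PQ+R R<m with ≈[]? R
  ...   | yes R≈[] = inj₁ (division⇒∣ A≈PQ+R R≈[])
  ...   | no  R≉[] = inj₂ (euclid-small irr m R B R<m R≉[] ≤-refl (∣-⊛-remainder {X = P} A≈PQ+R P∣AB (∣-self-⊛ P B)))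

  length-⊕ : ∀ f g → length (f ⊕ g) ≡ length f ⊔ length g
  length-⊕ []      g       = refl
  length-⊕ (a ∷ f) []      = refl
  length-⊕ (a ∷ f) (b ∷ g) = cong suc (length-⊕ f g)

  length-⊛ : ∀ a f b g → length ((a ∷ f) ⊛ (b ∷ g)) ≡ suc (length f + length g)
  length-⊛ a []      b g = trans (length-⊕ (a · (b ∷ g)) (0ᶠ ∷ []))
    (trans (cong (_⊔ 1) (length-map _ (b ∷ g))) (cong suc (⊔-identityʳ _)))
  length-⊛ a (c ∷ f) b g = trans (length-⊕ (a · (b ∷ g)) (0ᶠ ∷ ((c ∷ f) ⊛ (b ∷ g))))
    (trans (cong₂ _⊔_ (length-map _ (b ∷ g)) (cong suc (length-⊛ c f b g)))
           (cong suc (m≤n⇒m⊔n≡n (≤-trans (m≤n+m (length g) (length f)) (n≤1+n _)))))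

  length-monic : ∀ {m} (v : Vec (Fin q) m) → length (monic v) ≡ suc m
  length-monic []ᵥ       = refl
  length-monic (a ∷ᵥ v) = cong suc (length-monic v)

  length-monic-⊛ : ∀ {m n} (v : Vec (Fin q) m) (w : Vec (Fin q) n) → length (monic v ⊛ monic w) ≡ suc (m + n)
  length-monic-⊛ {m} {n} v w = nonempty (monic v) (monic w) (length-monic v) (length-monic w)
    where
    nonempty : ∀ f g → length f ≡ suc m → length g ≡ suc n → length (f ⊛ g) ≡ suc (m + n)
    nonempty (a ∷ f) (b ∷ g) lf lg = trans (length-⊛ a f b g) (cong suc (cong₂ _+_ (suc-injective lf) (suc-injective lg)))

  -- The Boolean predicates of Defs compare coefficient lists with _==_, so ≈ has to be
  -- upgraded to ≡, which needs equal lengths.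
  ≈∧length≡⇒≡ : ∀ f g → f ≈ g → length f ≡ length g → f ≡ g
  ≈∧length≡⇒≡ []      []      _   _   = refl
  ≈∧length≡⇒≡ (a ∷ f) (b ∷ g) f≈g len = cong₂ _∷_ (at f≈g 0) (≈∧length≡⇒≡ f g (tl-cong f≈g) (suc-injective len))

  cofactor-vector : ∀ {m n} (P : Vec (Fin q) m) (f : Vec (Fin q) n) {Y} → monic P ⊛ Y ≈ monic f →
                    m ≤ n × Σ (Vec (Fin q) (n ∸ m)) λ g → monic P ⊛ monic g ≡ monic f
  cofactor-vector {m} {n} P f {Y} PY≈f with monic-cofactor (Monic-monic P) (Monic-monic f) PY≈f
  ... | m≤n , monic-Y = m≤n , g , ≈∧length≡⇒≡ _ _ Pg≈f lengths
    where
    g = lowerCoeffs (n ∸ m) Y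
    Pg≈f = ≈-trans (⊛-congʳ (monic P) (monic-lowerCoeffs (n ∸ m) monic-Y)) PY≈f
    lengths = trans (length-monic-⊛ P g) (trans (cong suc (m+[n∸m]≡n m≤n)) (sym (length-monic f)))

  divides-sound : ∀ {m n} (P : Vec (Fin q) m) (f : Vec (Fin q) n) → T (divides P f) → monic P ∣ monic f
  divides-sound {m} {n} P f P|f with m ≤? n
  ... | yes _ with find (Anyₚ.any⁻ _ (allVecs q (n ∸ m)) P|f)
  ...   | g , _ , Pg==f = dvd (monic g) (≈-reflexive (sym (toWitness Pg==f)))

  divides-complete : ∀ {m n} (P : Vec (Fin q) m) (f : Vec (Fin q) n) → monic P ∣ monic f → T (divides P f)
  divides-complete {m} {n} P f (dvd Y f≈PY) with cofactor-vector P f (≈-sym f≈PY)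
  ... | m≤n , g , Pg≡f with m ≤? n
  ...   | no  m≰n = ⊥-elim (m≰n m≤n)
  ...   | yes _   = Anyₚ.any⁺ _ (Any.map (λ { refl → fromWitness Pg≡f }) (∈-allVecs (n ∸ m) g))

  irreducible-sound : ∀ {m} (P : Vec (Fin q) (suc m)) → T (irreducible P) → Irreducible (suc m) (monic P)
  irreducible-sound {m} P P-irr = record
    { monic-irreducible = Monic-monic P ; positive-degree = s≤s z≤n ; no-proper-factor = no-factor }
    where
    no-factor : ∀ {a A B} → Monic a A → 1 ≤ a → a < suc m → A ⊛ B ≈ monic P → ⊥
    no-factor {suc i} {A} monic-A _ (s≤s i<m) AB≈P =
      refute (cofactor-vector vA P (≈-trans (⊛-congˡ _ (monic-lowerCoeffs (suc i) monic-A)) AB≈P))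
      where
      vA = lowerCoeffs (suc i) A
      refute : suc i ≤ suc m × Σ (Vec (Fin q) (suc m ∸ suc i)) (λ g → monic vA ⊛ monic g ≡ monic P) → ⊥
      refute (_ , g , vAg≡P) = T-not⇒¬T
        (T-all-lookup (T-all-lookup (T-all-lookup P-irr (∈-upTo⁺ i<m)) (∈-allVecs _ vA)) (∈-allVecs _ g))
        (fromWitness vAg≡P)

  reducible-factorization : ∀ {m} (P : Vec (Fin q) (suc m)) → ¬ T (irreducible P) →
    Σ ℕ λ i → i < m × Σ (Vec (Fin q) (suc i)) λ A → Σ (Vec (Fin q) (suc m ∸ suc i)) λ B → monic A ⊛ monic B ≡ monic P
  reducible-factorization {m} P P-red with T-all-counterexample _ (upTo m) P-red
  ... | i , i∈ , ¬all-A with T-all-counterexample _ (allVecs q (suc i)) ¬all-A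
  ...   | A , _ , ¬all-B with T-all-counterexample _ (allVecs q (suc m ∸ suc i)) ¬all-B
  ...     | B , _ , AB==P = i , ∈-upTo⁻ i∈ , A , B , toWitness (¬T-not⇒T AB==P)

  IrreducibleDivisor : ∀ {n} → Vec (Fin q) n → Set
  IrreducibleDivisor f = Σ ℕ λ j → Σ (Vec (Fin q) (suc j)) λ P → T (irreducible P) × monic P ∣ monic f

  irreducible-divisor : ∀ n (f : Vec (Fin q) (suc n)) → IrreducibleDivisor f
  irreducible-divisor = <-rec (λ n → ∀ f → IrreducibleDivisor f) step
    where
    step : ∀ n → (∀ {i} → i < n → ∀ f → IrreducibleDivisor f) → ∀ f → IrreducibleDivisor f
    step n smaller f with T? (irreducible f)
    ... | yes f-irr = n , f , f-irr , ∣-refl (monic f)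
    ... | no  f-red with reducible-factorization f f-red
    ...   | i , i<n , A , B , AB≡f with smaller i<n A
    ...     | j , P , P-irr , P∣A = j , P , P-irr , ∣-trans P∣A (dvd (monic B) (≈-reflexive (sym AB≡f)))

module Factorization {q : ℕ} (F : FiniteField q) where

  open FiniteField F
  open Poly F
  open Polynomials F

  MonicVec : Set
  MonicVec = Σ ℕ (Vec (Fin q))

  withDegree : ∀ D → Vec (Fin q) D → MonicVec
  withDegree = _,_

  toPol : MonicVec → Pol
  toPol (_ , v) = monic v

  deg : MonicVec → ℕ
  deg = proj₁

  monic-toPol : ∀ x → Monic (deg x) (toPol x)
  monic-toPol (_ , P) = Monic-monic P

  ∣⇒deg≤ : ∀ {j n} (P : Vec (Fin q) j) (f : Vec (Fin q) n) → monic P ∣ monic f → j ≤ n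
  ∣⇒deg≤ P f (dvd Y f≈PY) = proj₁ (monic-cofactor (Monic-monic P) (Monic-monic f) (≈-sym f≈PY))

  IsIrreducible : MonicVec → Set
  IsIrreducible (_ , v) = T (irreducible v)

  irreducible-toPol : ∀ {x} → IsIrreducible x → Irreducible (deg x) (toPol x)
  irreducible-toPol {zero  , v} ()
  irreducible-toPol {suc _ , v} = irreducible-sound v

  toPol-injective : ∀ x y → toPol x ≈ toPol y → x ≡ y
  toPol-injective (j , P) (k , Q) P≈Q with monic-degree-unique (monic-resp-≈ P≈Q (Monic-monic P)) (Monic-monic Q)
  ... | refl = cong (withDegree j) (monic-injective P Q P≈Q)

  irreducibleDivisor? : ∀ {n} → Vec (Fin q) n → ∀ {j} → Vec (Fin q) (suc j) → Bool
  irreducibleDivisor? f P = irreducible P ∧ divides P f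

  irreducibleDivisor?-sound : ∀ {n} (f : Vec (Fin q) n) {j} (P : Vec (Fin q) (suc j)) →
                              T (irreducibleDivisor? f P) → T (irreducible P) × monic P ∣ monic f
  irreducibleDivisor?-sound f P P-irr∣f with Equivalence.to T-∧ P-irr∣f
  ... | P-irr , P|f = P-irr , divides-sound P f P|f

  irreducibleDivisor?-complete : ∀ {n} (f : Vec (Fin q) n) {j} (P : Vec (Fin q) (suc j)) →
                                 T (irreducible P) → monic P ∣ monic f → T (irreducibleDivisor? f P)
  irreducibleDivisor?-complete f P P-irr P∣f = Equivalence.from T-∧ (P-irr , divides-complete P f P∣f)

  irreducibleDivisorsOfDegree : ∀ {n} → Vec (Fin q) n → ℕ → List MonicVec
  irreducibleDivisorsOfDegree f j = map (withDegree (suc j)) (filter (T? ∘ irreducibleDivisor? f) (allVecs q (suc j)))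

  irreducibleDivisors : ℕ → ∀ {n} → Vec (Fin q) n → List MonicVec
  irreducibleDivisors N f = concatMap (irreducibleDivisorsOfDegree f) (upTo N)

  totalDegree : List MonicVec → ℕ
  totalDegree U = sum (map deg U)

  degRad≡totalDegree : ∀ {n} (f : Vec (Fin q) n) → degRad f ≡ totalDegree (irreducibleDivisors n f)
  degRad≡totalDegree {n} f = sym (trans (sum-map-concatMap deg (irreducibleDivisorsOfDegree f) (upTo n))
    (cong sum (map-cong (λ j → trans (cong sum (sym (map-∘ (allVecs-filtered j))))
                                      (sum-map-filter (irreducibleDivisor? f) (λ _ → suc j) (allVecs q (suc j))))
                        (upTo n))))
    where allVecs-filtered = λ j → filter (T? ∘ irreducibleDivisor? f) (allVecs q (suc j))

  ∈-irreducibleDivisors⁺ : ∀ N {n} (f : Vec (Fin q) n) {j} (P : Vec (Fin q) (suc j)) →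
    j < N → T (irreducible P) → monic P ∣ monic f → (suc j , P) ∈ irreducibleDivisors N f
  ∈-irreducibleDivisors⁺ N f {j} P j<N P-irr P∣f = ∈-concatMap⁺ (irreducibleDivisorsOfDegree f)
    (Any.map (λ { refl → ∈-map⁺ (withDegree (suc j)) (∈-filter⁺ (T? ∘ irreducibleDivisor? f) (∈-allVecs _ P) P-irr∣f) }) (∈-upTo⁺ j<N))
    where P-irr∣f = irreducibleDivisor?-complete f P P-irr P∣f

  ∈-irreducibleDivisors⁻ : ∀ N {n} (f : Vec (Fin q) n) {x} → x ∈ irreducibleDivisors N f →
    IsIrreducible x × toPol x ∣ monic f
  ∈-irreducibleDivisors⁻ N f x∈ with find (∈-concatMap⁻ (irreducibleDivisorsOfDegree f) {xs = upTo N} x∈)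
  ... | j , _ , x∈block with ∈-map⁻ (withDegree (suc j)) x∈block
  ...   | P , P∈ , refl = irreducibleDivisor?-sound f P (proj₂ (∈-filter⁻ (T? ∘ irreducibleDivisor? f) {xs = allVecs q (suc j)} P∈))

  irreducibleDivisors-unique : ∀ N {n} (f : Vec (Fin q) n) → Unique (irreducibleDivisors N f)
  irreducibleDivisors-unique N f = Uniqueₚ.concat⁺ (Allₚ.map⁺ (All.universal block-unique (upTo N)))
                                                  (AllPairsₚ.map⁺ (AllPairs.map blocks-disjoint (Uniqueₚ.upTo⁺ N)))
    where
    block-unique : ∀ j → Unique (irreducibleDivisorsOfDegree f j)
    block-unique j = Uniqueₚ.map⁺ (λ { refl → refl }) (Uniqueₚ.filter⁺ (T? ∘ irreducibleDivisor? f) (allVecs-unique q (suc j)))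
    blocks-disjoint : ∀ {j k} → j ≢ k → Disjoint (irreducibleDivisorsOfDegree f j) (irreducibleDivisorsOfDegree f k)
    blocks-disjoint j≢k (x∈j , x∈k) with ∈-map⁻ _ x∈j | ∈-map⁻ _ x∈k
    ... | _ , _ , refl | _ , _ , refl = j≢k refl

  product : List MonicVec → Pol
  product = foldr (λ x → toPol x ⊛_) one

  monic-product : ∀ U → Monic (totalDegree U) (product U)
  monic-product []      = monic-one
  monic-product (x ∷ U) = monic-⊛ (monic-toPol x) (monic-product U)

  ∈⇒∣-product : ∀ {x U} → x ∈ U → toPol x ∣ product U
  ∈⇒∣-product {x} {_ ∷ U} (here refl) = ∣-self-⊛ (toPol x) (product U)
  ∈⇒∣-product {U = y ∷ _} (there x∈U) = ∣-⊛ˡ (toPol y) (∈⇒∣-product x∈U)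

  AllIrreducible : List MonicVec → Set
  AllIrreducible U = ∀ {x} → x ∈ U → IsIrreducible x

  irreducible-∣-irreducible : ∀ {x y} → IsIrreducible x → IsIrreducible y → toPol x ∣ toPol y → x ≡ y
  irreducible-∣-irreducible {x} {y} x-irr y-irr (dvd Y y≈xY)
    with monic-cofactor (monic-toPol x) (monic-toPol y) (≈-sym y≈xY)
  ... | dx≤dy , monic-Y with m≤n⇒m<n∨m≡n dx≤dy
  ...   | inj₁ dx<dy = ⊥-elim (no-proper-factor (irreducible-toPol {y} y-irr) (monic-toPol x) 1≤dx dx<dy (≈-sym y≈xY))
    where 1≤dx = positive-degree (irreducible-toPol {x} x-irr)
  ...   | inj₂ dx≡dy = toPol-injective x y (≈-sym (≈-trans y≈xY (≈-trans (⊛-congʳ (toPol x) Y≈one) (⊛-identityʳ (toPol x)))))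
    where
    Y≈one = monic-zero⇒≈one (subst (λ k → Monic k Y) (trans (cong (deg y ∸_) dx≡dy) (n∸n≡0 (deg y))) monic-Y)

  irreducible-∣-product⇒∈ : ∀ {y} U → IsIrreducible y → AllIrreducible U → toPol y ∣ product U → y ∈ U
  irreducible-∣-product⇒∈ {y} []      y-irr _       (dvd Y one≈yY)
    with ≤-trans (positive-degree (irreducible-toPol {y} y-irr)) (proj₁ (monic-cofactor (monic-toPol y) monic-one (≈-sym one≈yY)))
  ... | ()
  irreducible-∣-product⇒∈ {y} (x ∷ U) y-irr U-irr y∣xU with euclid (irreducible-toPol {y} y-irr) (toPol x) (product U) y∣xU
  ... | inj₁ y∣x = here (irreducible-∣-irreducible y-irr (U-irr (here refl)) y∣x)
  ... | inj₂ y∣U = there (irreducible-∣-product⇒∈ U y-irr (U-irr ∘ there) y∣U)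

  product-∣ : ∀ {G} U → Unique U → AllIrreducible U → (∀ {x} → x ∈ U → toPol x ∣ G) → product U ∣ G
  product-∣ {G} []      _              _     _    = dvd G (≈-sym (⊛-identityˡ G))
  product-∣ {G} (x ∷ U) (x∉U ∷ U-uniq) U-irr U∣G with product-∣ U U-uniq (U-irr ∘ there) (U∣G ∘ there)
  ... | dvd H G≈UH with euclid (irreducible-toPol {x} (U-irr (here refl))) (product U) H (∣-resp-≈ʳ G≈UH (U∣G (here refl)))
  ...   | inj₁ x∣U = ⊥-elim (All.lookup x∉U (irreducible-∣-product⇒∈ U (U-irr (here refl)) (U-irr ∘ there) x∣U) refl)
  ...   | inj₂ (dvd H′ H≈xH′) = dvd H′ (begin
    G                           ≈⟨ G≈UH ⟩
    product U ⊛ H               ≈⟨ ⊛-congʳ (product U) H≈xH′ ⟩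
    product U ⊛ (toPol x ⊛ H′)  ≈⟨ ⊛-Semigroup.x∙yz≈yx∙z (product U) (toPol x) H′ ⟩
    (toPol x ⊛ product U) ⊛ H′  ∎)
    where open SetoidReasoning ≈-setoid

  totalDegree-≤ : ∀ N {n m G} (f : Vec (Fin q) n) → Monic m G →
                  (∀ {x} → x ∈ irreducibleDivisors N f → toPol x ∣ G) → totalDegree (irreducibleDivisors N f) ≤ m
  totalDegree-≤ N f monic-G divisors∣G
    with product-∣ (irreducibleDivisors N f) (irreducibleDivisors-unique N f) (proj₁ ∘ ∈-irreducibleDivisors⁻ N f) divisors∣G
  ... | dvd H G≈UH = proj₁ (monic-cofactor (monic-product (irreducibleDivisors N f)) monic-G (≈-sym G≈UH))

  infixr 25 _^ₚ_
  _^ₚ_ : Pol → ℕ → Pol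
  P ^ₚ zero  = one
  P ^ₚ suc e = P ⊛ P ^ₚ e

  monic-^ₚ : ∀ {d P} → Monic d P → ∀ e → Monic (e * d) (P ^ₚ e)
  monic-^ₚ monic-P zero    = monic-one
  monic-^ₚ monic-P (suc e) = monic-⊛ monic-P (monic-^ₚ monic-P e)

  productOfPowers : List MonicVec → List ℕ → Pol
  productOfPowers (x ∷ U) (e ∷ es) = toPol x ^ₚ e ⊛ productOfPowers U es
  productOfPowers _       _        = one

  monic-productOfPowers : ∀ U es → Monic (weightedSum (map deg U) es) (productOfPowers U es)
  monic-productOfPowers (x ∷ U) (e ∷ es) = monic-⊛ (monic-^ₚ (monic-toPol x) e) (monic-productOfPowers U es)
  monic-productOfPowers []      _        = monic-one
  monic-productOfPowers (x ∷ U) []       = monic-one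

  zeroExponents : List MonicVec → List ℕ
  zeroExponents = map λ _ → 0

  productOfPowers-zeroExponents : ∀ U → productOfPowers U (zeroExponents U) ≈ one
  productOfPowers-zeroExponents []      = ≈-refl
  productOfPowers-zeroExponents (x ∷ U) = ≈-trans (⊛-identityˡ _) (productOfPowers-zeroExponents U)

  incrementAt : ∀ {x : MonicVec} {U} → x ∈ U → List ℕ → List ℕ
  incrementAt (here _)  (e ∷ es) = suc e ∷ es
  incrementAt (there p) (e ∷ es) = e ∷ incrementAt p es
  incrementAt _         []       = []

  length-incrementAt : ∀ {x : MonicVec} {U} (p : x ∈ U) es → length es ≡ length U → length (incrementAt p es) ≡ length U
  length-incrementAt (here _)  (e ∷ es) len = len
  length-incrementAt (there p) (e ∷ es) len = cong suc (length-incrementAt p es (suc-injective len))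

  ⊛-productOfPowers : ∀ {x U} (p : x ∈ U) es → length es ≡ length U →
                      toPol x ⊛ productOfPowers U es ≈ productOfPowers U (incrementAt p es)
  ⊛-productOfPowers {x} (here refl) (e ∷ es) _   = ≈-sym (⊛-assoc (toPol x) (toPol x ^ₚ e) _)
  ⊛-productOfPowers {x} {y ∷ U} (there p) (e ∷ es) len =
    ≈-trans (⊛-Semigroup.x∙yz≈y∙xz (toPol x) (toPol y ^ₚ e) (productOfPowers U es))
            (⊛-congʳ (toPol y ^ₚ e) (⊛-productOfPowers p es (suc-injective len)))

  record PowerFactorization (U : List MonicVec) {m} (f : Vec (Fin q) m) : Set where
    constructor powerFactorization
    field
      exponents        : List ℕ
      exponents-length : length exponents ≡ length U
      factorization    : monic f ≈ productOfPowers U exponents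

  IrreducibleDivisorsIn : List MonicVec → ∀ {m} → Vec (Fin q) m → Set
  IrreducibleDivisorsIn U f = ∀ {j} (P : Vec (Fin q) (suc j)) → T (irreducible P) → monic P ∣ monic f → (suc j , P) ∈ U

  power-factorization : ∀ U m (f : Vec (Fin q) m) → IrreducibleDivisorsIn U f → PowerFactorization U f
  power-factorization U = <-rec (λ m → ∀ f → IrreducibleDivisorsIn U f → PowerFactorization U f) step
    where
    step : ∀ m → (∀ {k} → k < m → ∀ f → IrreducibleDivisorsIn U f → PowerFactorization U f) →
           ∀ f → IrreducibleDivisorsIn U f → PowerFactorization U f
    step zero    _       []ᵥ _ = powerFactorization (zeroExponents U) (length-map _ U) (≈-sym (productOfPowers-zeroExponents U))
    step (suc m) smaller f U-complete with irreducible-divisor m f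
    ... | j , P , P-irr , P∣f@(dvd Y f≈PY) = extend (smaller (s≤s (m∸n≤m m j)) h h-complete)
      where
      monic-Y = proj₂ (monic-cofactor (Monic-monic P) (Monic-monic f) (≈-sym f≈PY))
      h = lowerCoeffs (suc m ∸ suc j) Y
      f≈Ph : monic f ≈ monic P ⊛ monic h
      f≈Ph = ≈-trans f≈PY (⊛-congʳ (monic P) (≈-sym (monic-lowerCoeffs _ monic-Y)))
      h-complete : IrreducibleDivisorsIn U h
      h-complete Q Q-irr Q∣h = U-complete Q Q-irr (∣-trans Q∣h (dvd (monic P) (≈-trans f≈Ph (⊛-comm (monic P) (monic h)))))
      P∈U = U-complete P P-irr P∣f
      extend : PowerFactorization U h → PowerFactorization U f
      extend (powerFactorization es len h≈U) = powerFactorization (incrementAt P∈U es) (length-incrementAt P∈U es len)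
        (≈-trans f≈Ph (≈-trans (⊛-congʳ (monic P) h≈U) (⊛-productOfPowers P∈U es len)))

  radicalDegree : ∀ {n} → Vec (Fin q) n → ℕ
  radicalDegree {n} f = totalDegree (irreducibleDivisors n f)

  radical : ∀ {n} (f : Vec (Fin q) n) → Vec (Fin q) (radicalDegree f)
  radical {n} f = lowerCoeffs (radicalDegree f) (product (irreducibleDivisors n f))

  monic-radical : ∀ {n} (f : Vec (Fin q) n) → monic (radical f) ≈ product (irreducibleDivisors n f)
  monic-radical {n} f = monic-lowerCoeffs _ (monic-product (irreducibleDivisors n f))

  irreducibleDivisors-radical : ∀ {n} (f : Vec (Fin q) n) → irreducibleDivisors n (radical f) ≡ irreducibleDivisors n f
  irreducibleDivisors-radical {n} f =
    concatMap-cong (λ j → cong (map (withDegree (suc j))) (filter-≐ _ _ (r⇒f , f⇒r) (allVecs q (suc j)))) (upTo n)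
    where
    U = irreducibleDivisors n f
    r⇒f : ∀ {j} {P : Vec (Fin q) (suc j)} → T (irreducibleDivisor? (radical f) P) → T (irreducibleDivisor? f P)
    r⇒f {j} {P} P-irr∣r with irreducibleDivisor?-sound (radical f) P P-irr∣r
    ... | P-irr , P∣r = irreducibleDivisor?-complete f P P-irr (proj₂ (∈-irreducibleDivisors⁻ n f P∈U))
      where P∈U = irreducible-∣-product⇒∈ U P-irr (proj₁ ∘ ∈-irreducibleDivisors⁻ n f) (∣-resp-≈ʳ (monic-radical f) P∣r)
    f⇒r : ∀ {j} {P : Vec (Fin q) (suc j)} → T (irreducibleDivisor? f P) → T (irreducibleDivisor? (radical f) P)
    f⇒r {j} {P} P-irr∣f with irreducibleDivisor?-sound f P P-irr∣f
    ... | P-irr , P∣f = irreducibleDivisor?-complete (radical f) P P-irr (∣-resp-≈ʳ (≈-sym (monic-radical f)) (∈⇒∣-product P∈U))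
      where P∈U = ∈-irreducibleDivisors⁺ n f P (∣⇒deg≤ P f P∣f) P-irr P∣f

module Counting {q : ℕ} (F : FiniteField q) where

  open FiniteField F
  open Poly F
  open Polynomials F
  open Factorization F

  2≤q : 2 ≤ q
  2≤q with 2 ≤? q
  ... | yes 2≤q = 2≤q
  ... | no  2≰q = ⊥-elim (0≢1 (toℕ-injective (trans (n<1⇒n≡0 (<-≤-trans (toℕ<n 0ᶠ) q≤1)) (sym (n<1⇒n≡0 (<-≤-trans (toℕ<n 1ᶠ) q≤1))))))
    where q≤1 = ≤-pred (≰⇒> 2≰q)

  instance
    q-nonZero : NonZero q
    q-nonZero = >-nonZero (<-trans (s≤s z≤n) 2≤q)

  Code : Set
  Code = MonicVec × List ℕ

  decode : ℕ → Code → Pol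
  decode n ((_ , r) , es) = productOfPowers (irreducibleDivisors n r) es

  exponentsOf : ∀ {n} (f : Vec (Fin q) n) → PowerFactorization (irreducibleDivisors n f) f
  exponentsOf {n} f = power-factorization (irreducibleDivisors n f) n f
    (λ P P-irr P∣f → ∈-irreducibleDivisors⁺ n f P (∣⇒deg≤ P f P∣f) P-irr P∣f)

  encode : ∀ {n} → Vec (Fin q) n → Code
  encode f = (radicalDegree f , radical f) , PowerFactorization.exponents (exponentsOf f)

  decode-encode : ∀ {n} (f : Vec (Fin q) n) → monic f ≈ decode n (encode f)
  decode-encode {n} f = ≈-trans (PowerFactorization.factorization (exponentsOf f))
    (≈-reflexive (cong (λ U → productOfPowers U (PowerFactorization.exponents (exponentsOf f))) (sym (irreducibleDivisors-radical f))))

  encode-injective : ∀ {n} {f g : Vec (Fin q) n} → encode f ≡ encode g → f ≡ g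
  encode-injective {n} {f} {g} f≡g = monic-injective f g
    (≈-trans (decode-encode f) (≈-trans (≈-reflexive (cong (decode n) f≡g)) (≈-sym (decode-encode g))))

  monicsOfDegree : ℕ → List MonicVec
  monicsOfDegree D = map (withDegree D) (allVecs q D)

  monicsOfDegreeBelow : ℕ → List MonicVec
  monicsOfDegreeBelow L = concatMap monicsOfDegree (upTo L)

  length-monicsOfDegreeBelow : ∀ L d → L ≤ suc d → length (monicsOfDegreeBelow L) ≤ L * q ^ d
  length-monicsOfDegreeBelow L d L≤1+d =
    ≤-trans (length-concatMap-≤ monicsOfDegree (upTo L) block≤) (≤-reflexive (cong (_* q ^ d) (length-upTo L)))
    where
    block≤ : ∀ {D} → D ∈ upTo L → length (monicsOfDegree D) ≤ q ^ d
    block≤ {D} D∈ = ≤-trans (≤-reflexive (trans (length-map (withDegree D) (allVecs q D)) (length-allVecs q D)))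
                            (^-monoʳ-≤ q (≤-pred (≤-trans (∈-upTo⁻ D∈) L≤1+d)))

  smallCount-map : ∀ L U → smallCount L (map deg U) ≡ length (filter (λ x → deg x <? L) U)
  smallCount-map L []      = refl
  smallCount-map L (x ∷ U) with deg x <? L
  ... | yes small = trans (cong suc (smallCount-map L U)) (cong length (sym (filter-accept (λ y → deg y <? L) small)))
  ... | no  large = trans (smallCount-map L U) (cong length (sym (filter-reject (λ y → deg y <? L) large)))

  smallCount-≤ : ∀ L U → Unique U → smallCount L (map deg U) ≤ L * q ^ L
  smallCount-≤ L U U-unique = begin
    smallCount L (map deg U)              ≡⟨ smallCount-map L U ⟩
    length (filter (λ x → deg x <? L) U)  ≤⟨ Unique-⊆⇒length≤ (Uniqueₚ.filter⁺ (λ x → deg x <? L) U-unique) small⊆ ⟩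
    length (monicsOfDegreeBelow L)        ≤⟨ length-monicsOfDegreeBelow L L (n≤1+n L) ⟩
    L * q ^ L                             ∎
    where
    open ≤-Reasoning
    small⊆ : filter (λ x → deg x <? L) U ⊆ monicsOfDegreeBelow L
    small⊆ {D , v} x∈ = ∈-concatMap⁺ monicsOfDegree
      (Any.map (λ { refl → ∈-map⁺ (withDegree D) (∈-allVecs D v) }) (∈-upTo⁺ (proj₂ (∈-filter⁻ (λ x → deg x <? L) {xs = U} x∈))))

  exponentCandidates : (L n : ℕ) .{{_ : NonZero L}} → MonicVec → List (List ℕ)
  exponentCandidates L n (_ , r) = exponentVectors L (map deg (irreducibleDivisors n r)) n (n / L)

  codesOver : (L n : ℕ) .{{_ : NonZero L}} → MonicVec → List Code
  codesOver L n r = map (r ,_) (exponentCandidates L n r)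

  codes : (L n d : ℕ) .{{_ : NonZero L}} → List Code
  codes L n d = concatMap (codesOver L n) (monicsOfDegreeBelow (suc d))

  exponentBound : (L n : ℕ) .{{_ : NonZero L}} → ℕ
  exponentBound L n = suc n ^ (L * q ^ L) * 2 ^ (n / L + n / L)

  length-exponentCandidates : ∀ L n .{{_ : NonZero L}} {D} (r : Vec (Fin q) D) → D ≤ n →
                              length (exponentCandidates L n (D , r)) ≤ exponentBound L n
  length-exponentCandidates L n {D} r D≤n = begin
    length (exponentVectors L δs n (n / L))                   ≤⟨ length-exponentVectors L δs n (n / L) ⟩
    suc n ^ smallCount L δs * 2 ^ (n / L + largeCount L δs)   ≤⟨ *-mono-≤ (^-monoʳ-≤ (suc n) small≤) (^-monoʳ-≤ 2 (+-monoʳ-≤ (n / L) large≤)) ⟩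
    exponentBound L n                                         ∎
    where
    open ≤-Reasoning
    U = irreducibleDivisors n r
    δs = map deg U
    small≤ = smallCount-≤ L U (irreducibleDivisors-unique n r)
    sum≤n : sum δs ≤ n
    sum≤n = ≤-trans (totalDegree-≤ n r (Monic-monic r) (proj₂ ∘ ∈-irreducibleDivisors⁻ n r)) D≤n
    large≤ = n*m≤o⇒m≤o/n (largeCount L δs) L n (≤-trans (L*largeCount≤sum L δs) sum≤n)

  length-codes : ∀ L n d .{{_ : NonZero L}} → d ≤ n → length (codes L n d) ≤ suc d * q ^ d * exponentBound L n
  length-codes L n d d≤n = begin
    length (codes L n d)                                      ≤⟨ length-concatMap-≤ (codesOver L n) (monicsOfDegreeBelow (suc d)) block≤ ⟩
    length (monicsOfDegreeBelow (suc d)) * exponentBound L n  ≤⟨ *-monoˡ-≤ _ (length-monicsOfDegreeBelow (suc d) d ≤-refl) ⟩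
    suc d * q ^ d * exponentBound L n                         ∎
    where
    open ≤-Reasoning
    block≤ : ∀ {r} → r ∈ monicsOfDegreeBelow (suc d) → length (codesOver L n r) ≤ exponentBound L n
    block≤ {D , r} r∈ with find (∈-concatMap⁻ monicsOfDegree r∈)
    ... | D , D∈ , r∈D with ∈-map⁻ (withDegree D) r∈D
    ...   | _ , _ , refl = ≤-trans (≤-reflexive (length-map _ (exponentCandidates L n (D , r))))
                                   (length-exponentCandidates L n r (≤-trans (≤-pred (∈-upTo⁻ D∈)) d≤n))

  encode-∈-codes : ∀ L n d .{{_ : NonZero L}} (f : Vec (Fin q) n) → degRad f ≤ d → encode f ∈ codes L n d
  encode-∈-codes L n d f degRad≤d = ∈-concatMap⁺ (codesOver L n) (Any.map (λ { refl → ∈-map⁺ ((radicalDegree f , radical f) ,_) es∈ }) radical∈)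
    where
    U = irreducibleDivisors n f
    P = exponentsOf f
    es = PowerFactorization.exponents P
    radical∈ : (radicalDegree f , radical f) ∈ monicsOfDegreeBelow (suc d)
    radical∈ = ∈-concatMap⁺ monicsOfDegree (Any.map (λ { refl → ∈-map⁺ (withDegree (radicalDegree f)) (∈-allVecs _ (radical f)) })
                 (∈-upTo⁺ (s≤s (subst (_≤ d) (degRad≡totalDegree f) degRad≤d))))
    weight≡n : weightedSum (map deg U) es ≡ n
    weight≡n = monic-degree-unique (monic-productOfPowers U es) (monic-resp-≈ (PowerFactorization.factorization P) (Monic-monic f))
    positive : All (1 ≤_) (map deg U)
    positive = Allₚ.map⁺ (All.tabulate λ {x} x∈ → positive-degree (irreducible-toPol {x} (proj₁ (∈-irreducibleDivisors⁻ n f x∈))))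
    es∈ : es ∈ exponentCandidates L n (radicalDegree f , radical f)
    es∈ = subst (λ V → es ∈ exponentVectors L (map deg V) n (n / L)) (sym (irreducibleDivisors-radical f))
            (∈-exponentVectors L (map deg U) n (n / L) es positive
               (trans (PowerFactorization.exponents-length P) (sym (length-map deg U))) (≤-reflexive weight≡n)
               (n*m≤o⇒m≤o/n _ L n (≤-trans (L*largeExponentSum≤weightedSum L (map deg U) es) (≤-reflexive weight≡n))))

  count-upper : ∀ L n d .{{_ : NonZero L}} → d ≤ n → count n d ≤ suc d * q ^ d * exponentBound L n
  count-upper L n d d≤n = begin
    count n d                 ≡⟨ sym (length-map encode xs) ⟩
    length (map encode xs)    ≤⟨ Unique-⊆⇒length≤ (Uniqueₚ.map⁺ encode-injective (Uniqueₚ.filter⁺ radical≤d? (allVecs-unique q n))) encoded⊆ ⟩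
    length (codes L n d)      ≤⟨ length-codes L n d d≤n ⟩
    suc d * q ^ d * exponentBound L n ∎
    where
    open ≤-Reasoning
    radical≤d? = λ (f : Vec (Fin q) n) → degRad f ≤? d
    xs = filter radical≤d? (allVecs q n)
    encoded⊆ : map encode xs ⊆ codes L n d
    encoded⊆ c∈ with ∈-map⁻ encode c∈
    ... | f , f∈ , refl = encode-∈-codes L n d f (proj₂ (∈-filter⁻ radical≤d? {xs = allVecs q n} f∈))

  pad : ∀ e {m} → Vec (Fin q) m → Vec (Fin q) (e + m)
  pad zero    v = v
  pad (suc e) v = 0ᶠ ∷ᵥ pad e v

  pad-injective : ∀ e {m} {v w : Vec (Fin q) m} → pad e v ≡ pad e w → v ≡ w
  pad-injective zero    v≡w = v≡w
  pad-injective (suc e) eq  = pad-injective e (proj₂ (∷-injective eq))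

  monic-pad : ∀ e {m} (v : Vec (Fin q) m) → monic (pad e v) ≈ X^ e ⊛ monic v
  monic-pad zero    v = ≈-sym (⊛-identityˡ (monic v))
  monic-pad (suc e) v = ≈-trans (∷-cong refl (monic-pad e v)) (≈-sym (0∷-⊛ (X^ e) (monic v)))

  X^suc-⊛ : ∀ e g → X^ suc e ⊛ g ≈ X^ 1 ⊛ (X^ e ⊛ g)
  X^suc-⊛ e g = ≈-trans (0∷-⊛ (X^ e) g) (≈-sym (≈-trans (0∷-⊛ one _) (∷-cong refl (⊛-identityˡ _))))

  irreducible-∣-X^⊛ : ∀ {k P} → Irreducible k P → ∀ e g → P ∣ X^ suc e ⊛ g → P ∣ X^ 1 ⊛ g
  irreducible-∣-X^⊛ irr zero    g P∣Xg = P∣Xg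
  irreducible-∣-X^⊛ irr (suc e) g P∣XXg with euclid irr (X^ 1) _ (∣-resp-≈ʳ (X^suc-⊛ (suc e) g) P∣XXg)
  ... | inj₁ P∣X     = ∣-⊛ʳ g P∣X
  ... | inj₂ P∣X^e·g = irreducible-∣-X^⊛ irr e g P∣X^e·g

  degRad-pad : ∀ e {m} (v : Vec (Fin q) m) → degRad (pad (suc e) v) ≤ suc m
  degRad-pad e {m} v = subst (_≤ suc m) (sym (degRad≡totalDegree (pad (suc e) v)))
    (totalDegree-≤ (suc e + m) (pad (suc e) v) (monic-⊛ (monic-X^ 1) (Monic-monic v)) divides-X·v)
    where
    divides-X·v : ∀ {x} → x ∈ irreducibleDivisors (suc e + m) (pad (suc e) v) → toPol x ∣ X^ 1 ⊛ monic v
    divides-X·v {x} x∈ with ∈-irreducibleDivisors⁻ (suc e + m) (pad (suc e) v) x∈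
    ... | x-irr , x∣f = irreducible-∣-X^⊛ (irreducible-toPol {x} x-irr) e (monic v) (∣-resp-≈ʳ (monic-pad (suc e) v) x∣f)

  count-lower : ∀ e m → q ^ m ≤ count (suc e + m) (suc m)
  count-lower e m = begin
    q ^ m                                  ≡⟨ sym (trans (length-map (pad (suc e)) (allVecs q m)) (length-allVecs q m)) ⟩
    length (map (pad (suc e)) (allVecs q m)) ≤⟨ Unique-⊆⇒length≤ (Uniqueₚ.map⁺ (pad-injective (suc e)) (allVecs-unique q m)) padded⊆ ⟩
    count (suc e + m) (suc m)              ∎
    where
    open ≤-Reasoning
    padded⊆ : map (pad (suc e)) (allVecs q m) ⊆ filter (λ f → degRad f ≤? suc m) (allVecs q (suc e + m))
    padded⊆ f∈ with ∈-map⁻ (pad (suc e)) f∈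
    ... | v , _ , refl = ∈-filter⁺ (λ f → degRad f ≤? suc m) (∈-allVecs _ (pad (suc e) v)) (degRad-pad e v)

  -- c is the exponent of n + 1 in the k-th power of the upper bound, taken with L = 4k.
  threshold : ℕ → ℕ
  threshold k = k + 8 * c * c
    where c = suc (4 * k * q ^ (4 * k)) * k

  count-upper-power : ∀ k n d → 1 ≤ k → threshold k ≤ n → d < n → count n d ^ k ≤ q ^ (k * d + n)
  count-upper-power k@(suc _) n d _ large d<n = begin
    count n d ^ k                 ≤⟨ ^-upper {b = q ^ d} {x = X} k count≤ slack ⟩
    (q ^ d) ^ k * q ^ n           ≡⟨ cong (_* q ^ n) (trans (^-*-assoc q d k) (cong (q ^_) (*-comm d k))) ⟩
    q ^ (k * d) * q ^ n           ≡⟨ sym (^-distribˡ-+-* q (k * d) n) ⟩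
    q ^ (k * d + n)               ∎
    where
    open ≤-Reasoning
    L = 4 * k
    M = L * q ^ L
    X = suc n ^ suc M * 2 ^ (n / L + n / L)
    count≤ : count n d ≤ q ^ d * X
    count≤ = begin
      count n d                                           ≤⟨ count-upper L n d (<⇒≤ d<n) ⟩
      suc d * q ^ d * (suc n ^ M * 2 ^ (n / L + n / L))   ≤⟨ *-monoˡ-≤ _ (*-monoˡ-≤ (q ^ d) (<⇒≤ (s≤s d<n))) ⟩
      suc n * q ^ d * (suc n ^ M * 2 ^ (n / L + n / L))
        ≡⟨ solve 4 (λ a b c e → a :* b :* (c :* e) := b :* (a :* c :* e)) refl (suc n) (q ^ d) (suc n ^ M) (2 ^ (n / L + n / L)) ⟩
      q ^ d * X                                           ∎
    slack : X ^ k ≤ q ^ n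
    slack = ≤-trans (polynomial-exponential-slack k L M n ≤-refl (≤-trans (m≤n+m _ k) large)) (^-monoˡ-≤ n 2≤q)

  count-lower-power : ∀ k n d → 1 ≤ d → d ≤ n → k ≤ n → q ^ (k * d) ≤ count n d ^ k * q ^ n
  count-lower-power k n (suc d′) _ d≤n k≤n = ^-lower k n (subst (λ m → q ^ d′ ≤ count m (suc d′)) n-split (count-lower (n ∸ suc d′) d′)) k≤n
    where
    n-split : suc (n ∸ suc d′) + d′ ≡ n
    n-split = trans (sym (+-suc (n ∸ suc d′) d′)) (m∸n+n≡m d≤n)

open Counting using (threshold; count-upper-power; count-lower-power)

lemma3p1 : (q : ℕ) (F : FiniteField q) (k : ℕ) → 1 ≤ k →
    ∃ λ N → ∀ n d → N ≤ n → 1 ≤ d → d < n →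
      (Poly.count F n d ^ k ≤ q ^ (k * d + n)) ×
      (q ^ (k * d) ≤ Poly.count F n d ^ k * q ^ n)
lemma3p1 q F k 1≤k = threshold F k , λ n d N≤n 1≤d d<n →
  count-upper-power F k n d 1≤k N≤n d<n ,
  count-lower-power F k n d 1≤d (<⇒≤ d<n) (≤-trans (m≤m+n k _) N≤n)
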